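{- Let $n\ge 1$. The number of distinct interval posets $P(\pi)$ with $\pi$ ranging over the block-wise simple permutations in $\mathcal{S}_n$ is equal to the number of ways to place non-crossing diagonals in a convex $(n+1)$-gon such that no triangles or quadrilaterals are present.
   Context: For $\pi=a_1\cdots a_n\in\mathcal{S}_n$, an interval (block) of $\pi$ is a non-empty contiguous sequence of entries $a_ia_{i+1}\cdots a_{i+k}$ whose values form a contiguous set of integers $[a,b]$; intervals are identified with their value sets. The interval poset $P(\pi)$ is the set of all non-empty intervals of $\pi$, ordered by inclusion; two interval posets are the same when they consist of the same family of intervals. For permutations $p_1\in\mathcal{S}_k$, $p_2\in\mathcal{S}_m$ ($k,m\ge1$), the direct sum $p_1\oplus p_2\in\mathcal{S}_{k+m}$ is $p_1$ followed by $p_2$ with all values shifted up by $k$, and the skew sum $p_1\ominus p_2$ is $p_1$ with values shifted up by $m$ followed by $p_2$. A permutation $\pi$ is block-wise simple if it has no interval whose pattern (the permutation obtained by order-isomorphically relabeling its entries) is of the form $p_1\oplus p_2$ or $p_1\ominus p_2$. A triangle (resp. quadrilateral) is present in a placement of non-crossing diagonals if some region into which the diagonals cut the polygon is bounded by exactly three (resp. four) segments, each a side of the polygon or a chosen diagonal. -}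

module Defs where

open import Data.Nat using (ℕ; suc)
open import Data.Fin using (Fin; toℕ; _≤_; _<_)
open import Data.Fin.Permutation using (Permutation′; _⟨$⟩ʳ_)
open import Data.Bool using (Bool; T)
open import Data.Product using (_×_; ∃-syntax; Σ-syntax)
open import Data.Sum using (_⊎_)
open import Relation.Nullary using (¬_)
open import Relation.Binary.PropositionalEquality using (_≡_)
open import Function.Bundles using (_⇔_)

-- Permutations.  A permutation π ∈ S_n is a bijection Fin n → Fin n;
-- positions and values are both 0-based (Fin n).  val π k = a_{k+1}.

val : ∀ {n} → Permutation′ n → Fin n → Fin n
val π k = π ⟨$⟩ʳ k

Occupies : ∀ {n} → Permutation′ n → Fin n → Fin n → Fin n → Fin n → Set
Occupies π i j a b =
  (∀ k → i ≤ k → k ≤ j → (a ≤ val π k × val π k ≤ b)) ×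
  (∀ v → a ≤ v → v ≤ b → ∃[ k ] (i ≤ k × k ≤ j × val π k ≡ v))

IsBlock : ∀ {n} → Permutation′ n → Fin n → Fin n → Set
IsBlock π i j = i ≤ j × ∃[ a ] ∃[ b ] Occupies π i j a b

-- The non-empty value set [a,b] is an interval of π (intervals are
-- identified with their value sets).
IsInterval : ∀ {n} → Permutation′ n → Fin n → Fin n → Set
IsInterval π a b = a ≤ b × ∃[ i ] ∃[ j ] (i ≤ j × Occupies π i j a b)

DirectSumAt : ∀ {n} → Permutation′ n → Fin n → Fin n → Set
DirectSumAt {n} π i j = Σ[ m ∈ Fin n ] (i ≤ m × m < j ×
  (∀ k l → i ≤ k → k ≤ m → m < l → l ≤ j → val π k < val π l))

SkewSumAt : ∀ {n} → Permutation′ n → Fin n → Fin n → Set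
SkewSumAt {n} π i j = Σ[ m ∈ Fin n ] (i ≤ m × m < j ×
  (∀ k l → i ≤ k → k ≤ m → m < l → l ≤ j → val π l < val π k))

BlockWiseSimple : ∀ {n} → Permutation′ n → Set
BlockWiseSimple π = ∀ i j → IsBlock π i j → ¬ (DirectSumAt π i j ⊎ SkewSumAt π i j)

SamePoset : ∀ {n} → Permutation′ n → Permutation′ n → Set
SamePoset π σ = ∀ a b → (IsInterval π a b ⇔ IsInterval σ a b)

-- k is the number of distinct interval posets P(π), π ∈ S_n block-wise
-- simple: g lists k block-wise simple permutations with pairwise distinct
-- posets, and every block-wise simple π has the poset of some g i.
NumDistinctPosets : ℕ → ℕ → Set
NumDistinctPosets n k = Σ[ g ∈ (Fin k → Permutation′ n) ]
  ((∀ i → BlockWiseSimple (g i)) ×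
   (∀ i j → SamePoset (g i) (g j) → i ≡ j) ×
   (∀ π → BlockWiseSimple π → ∃[ i ] SamePoset π (g i)))

-- Convex m-gon with vertices 0,1,…,m-1 in cyclic order.

IsSide : (m : ℕ) → Fin m → Fin m → Set
IsSide m i j = suc (toℕ i) ≡ toℕ j ⊎ (toℕ i ≡ 0 × suc (toℕ j) ≡ m)

IsDiagonal : (m : ℕ) → Fin m → Fin m → Set
IsDiagonal m i j = i < j × ¬ IsSide m i j

-- A set of diagonals, given by its characteristic function on ordered
-- pairs (i,j), i < j.
DiagSet : ℕ → Set
DiagSet m = Fin m → Fin m → Bool

Chosen : ∀ {m} → DiagSet m → Fin m → Fin m → Set
Chosen D i j = T (D i j)

WellFormed : (m : ℕ) → DiagSet m → Set
WellFormed m D = ∀ i j → Chosen D i j → IsDiagonal m i j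

Crosses : ∀ {m} → Fin m → Fin m → Fin m → Fin m → Set
Crosses a b c d = a < c × c < b × b < d

NonCrossing : ∀ {m} → DiagSet m → Set
NonCrossing D = ∀ a b c d → Chosen D a b → Chosen D c d → ¬ Crosses a b c d

Seg : (m : ℕ) → DiagSet m → Fin m → Fin m → Set
Seg m D i j = IsSide m i j ⊎ Chosen D i j

-- A region bounded by exactly three segments: vertices i<j<k pairwise
-- joined by segments (no chosen diagonal can pass through such a triangle
-- in a non-crossing dissection).
HasTriangle : (m : ℕ) → DiagSet m → Set
HasTriangle m D = ∃[ i ] ∃[ j ] ∃[ k ]
  (i < j × j < k × Seg m D i j × Seg m D j k × Seg m D i k)

-- A region bounded by exactly four segments: vertices i<j<k<l with the
-- boundary i-j-k-l-i made of segments and neither inner diagonal chosen.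
HasQuadrilateral : (m : ℕ) → DiagSet m → Set
HasQuadrilateral m D = ∃[ i ] ∃[ j ] ∃[ k ] ∃[ l ]
  (i < j × j < k × k < l ×
   Seg m D i j × Seg m D j k × Seg m D k l × Seg m D i l ×
   ¬ Chosen D i k × ¬ Chosen D j l)

ValidPlacement : (m : ℕ) → DiagSet m → Set
ValidPlacement m D = WellFormed m D × NonCrossing D ×
  ¬ HasTriangle m D × ¬ HasQuadrilateral m D

SameSet : ∀ {m} → DiagSet m → DiagSet m → Set
SameSet D E = ∀ a b → D a b ≡ E a b

NumPlacements : ℕ → ℕ → Set
NumPlacements m k = Σ[ g ∈ (Fin k → DiagSet m) ]
  ((∀ i → ValidPlacement m (g i)) ×
   (∀ i j → SameSet (g i) (g j) → i ≡ j) ×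
   (∀ D → ValidPlacement m D → ∃[ i ] SameSet D (g i)))

{-# OPTIONS --safe #-}
module Submission where

-- Read the value interval [c, d] of a permutation of size n as the segment
-- {c, d+1} of the polygon with vertices 0, …, n: singletons become the sides
-- {c, c+1} and the whole range the side {0, n}. In a block-wise simple
-- permutation no two intervals overlap (the diagonals do not cross) and no
-- interval is the union of two or three adjacent ones (no triangle or
-- quadrilateral), so the remaining intervals form a valid placement, which in
-- turn determines P(π). Conversely every valid placement arises: an innermost
-- diagonal spans at least four sides; contract it, realize the smaller
-- placement by induction, and inflate the entry at its end by a simple
-- permutation of the matching size (one exists for every size ≥ 4). The
-- resulting bijection between posets and placements carries over the count.

open import Defs
open import Data.Nat
open import Data.Nat.Properties
open import Data.Nat.Induction using (<-rec)
open import Data.Product using (Σ; Σ-syntax; ∃-syntax; _×_; _,_; proj₁; proj₂)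
open import Data.Sum using (_⊎_; inj₁; inj₂; [_,_]′) renaming (map to ⊎-map)
open import Data.Empty using (⊥; ⊥-elim)
open import Data.Fin using (Fin; toℕ; fromℕ<; combine; remQuot) renaming (zero to fzero; suc to fsuc)
open import Data.Fin.Properties using (toℕ-fromℕ<; fromℕ<-toℕ; toℕ-injective; toℕ<n; remQuot-combine; combine-remQuot; all?; any?) renaming (suc-injective to fsuc-injective)
open import Data.Fin.Permutation using (Permutation′; _⟨$⟩ʳ_; _⟨$⟩ˡ_; permutation; inverseˡ; inverseʳ)
open import Data.Bool using (Bool; true; false; T; if_then_else_)
open import Relation.Nullary using (¬_; Dec; yes; no)
open import Relation.Nullary.Decidable using (_×-dec_; _⊎-dec_; _→-dec_; ¬?; T?; isYes; toWitness; fromWitness)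
open import Relation.Binary.PropositionalEquality
open import Relation.Binary.Definitions using (tri<; tri≈; tri>)
open import Function.Bundles using (_⇔_; mk⇔; Equivalence)

-- Permutations of {0, …, n-1} as functions on ℕ: p sends a position to its
-- value and q is its inverse; outside [0, n) both are unconstrained.
record Perm (n : ℕ) : Set where
  field
    p q : ℕ → ℕ
    p< : ∀ {k} → k < n → p k < n
    q< : ∀ {v} → v < n → q v < n
    p∘q : ∀ {v} → v < n → p (q v) ≡ v
    q∘p : ∀ {k} → k < n → q (p k) ≡ k

MapsInto : (ℕ → ℕ) → ℕ → ℕ → ℕ → ℕ → Set
MapsInto f i j a b = ∀ k → i ≤ k → k ≤ j → a ≤ f k × f k ≤ b

Occ : ∀ {n} → Perm n → ℕ → ℕ → ℕ → ℕ → Set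
Occ P i j a b = MapsInto (Perm.p P) i j a b × MapsInto (Perm.q P) a b i j

Interval : ∀ {n} → Perm n → ℕ → ℕ → Set
Interval {n} P a b = a ≤ b × b < n × ∃[ i ] ∃[ j ] (i ≤ j × j < n × Occ P i j a b)

Simple : ∀ {n} → Perm n → Set
Simple {n} P = ∀ {a b} → Interval P a b → a ≡ b ⊎ (a ≡ 0 × suc b ≡ n)

module _ {n} (P : Perm n) where
  open Perm P

  p-injective : ∀ {k k′} → k < n → k′ < n → p k ≡ p k′ → k ≡ k′
  p-injective {k} {k′} k<n k′<n e = trans (sym (q∘p k<n)) (trans (cong q e) (q∘p k′<n))

  Occ-point : ∀ {i j c} → j < n → i ≤ j → Occ P i j c c → i ≡ j
  Occ-point {i} {j} j<n i≤j (vals , _) = p-injective (≤-<-trans i≤j j<n) j<n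
    (trans (≤-antisym (proj₂ (vals i ≤-refl i≤j)) (proj₁ (vals i ≤-refl i≤j)))
      (sym (≤-antisym (proj₂ (vals j i≤j ≤-refl)) (proj₁ (vals j i≤j ≤-refl)))))

  singleton-Interval : ∀ {v} → v < n → Interval P v v
  singleton-Interval {v} v<n = ≤-refl , v<n , q v , q v , ≤-refl , q< v<n ,
      (λ k q≤k k≤q → let e = trans (cong p (≤-antisym k≤q q≤k)) (p∘q v<n) in ≤-reflexive (sym e) , ≤-reflexive e) ,
      (λ v′ v≤v′ v′≤v → let e = cong q (≤-antisym v′≤v v≤v′) in ≤-reflexive (sym e) , ≤-reflexive e)

  inverse : Perm n
  inverse = record { p = q ; q = p ; p< = q< ; q< = p< ; p∘q = q∘p ; q∘p = p∘q }

  whole-Interval : ∀ {d} → suc d ≡ n → Interval P 0 d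
  whole-Interval refl = z≤n , ≤-refl , 0 , _ , z≤n , ≤-refl ,
      (λ k _ k≤d → z≤n , ≤-pred (p< (s≤s k≤d))) ,
      (λ v _ v≤d → z≤n , ≤-pred (q< (s≤s v≤d)))

  Alternating : ℕ → Set
  Alternating m = ∀ v → suc v < n → (q v < m × m ≤ q (suc v)) ⊎ (m ≤ q v × q (suc v) < m)

  -- An interval with two values contains two consecutive ones, and these lie on
  -- opposite sides of position m.
  straddles : ∀ {m i j c d} → Alternating m → c < d → d < n → Occ P i j c d → i < m × m ≤ j
  straddles {m} {c = c} alt c<d d<n (_ , poss)
    with poss c ≤-refl (<⇒≤ c<d) | poss (suc c) (n≤1+n c) c<d | alt c (≤-<-trans c<d d<n)
  ... | i≤qc , qc≤j | i≤qc′ , qc′≤j | inj₁ (qc<m , m≤qc′) = ≤-<-trans i≤qc qc<m , ≤-trans m≤qc′ qc′≤j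
  ... | i≤qc , qc≤j | i≤qc′ , qc′≤j | inj₂ (m≤qc , qc′<m) = ≤-<-trans i≤qc′ qc′<m , ≤-trans m≤qc qc≤j

identity₁ : Perm 1
identity₁ = record { p = λ k → k ; q = λ v → v ; p< = λ h → h ; q< = λ h → h ; p∘q = λ _ → refl ; q∘p = λ _ → refl }

identity₁-simple : Simple identity₁
identity₁-simple (z≤n , s≤s z≤n , _) = inj₁ refl

data EvenOdd : ℕ → Set where
  even : ∀ i → EvenOdd (i + i)
  odd : ∀ i → EvenOdd (suc (i + i))

evenOdd : ∀ v → EvenOdd v
evenOdd zero = even 0
evenOdd (suc v) with evenOdd v
... | even i = odd i
... | odd i = subst EvenOdd (cong suc (+-suc i i)) (even (suc i))

odd? : ℕ → Bool
odd? zero = false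
odd? (suc zero) = true
odd? (suc (suc v)) = odd? v

odd?-even : ∀ i → odd? (i + i) ≡ false
odd?-even zero = refl
odd?-even (suc i) rewrite +-suc i i = odd?-even i

odd?-odd : ∀ i → odd? (suc (i + i)) ≡ true
odd?-odd zero = refl
odd?-odd (suc i) rewrite +-suc i i = odd?-odd i

double-<-cancel : ∀ {i m} → i + i < m + m → i < m
double-<-cancel {i} {m} h with i <? m
... | yes i<m = i<m
... | no i≮m = ⊥-elim (<⇒≱ h (+-mono-≤ (≮⇒≥ i≮m) (≮⇒≥ i≮m)))

double-< : ∀ {i m} → i < m → suc (i + i) < m + m
double-< {i} {m} h = subst (_≤ m + m) (+-suc (suc i) i) (+-mono-≤ h h)

-- 2 4 … 2m 1 3 … 2m-1 (one-based) is simple: a block holding two values holds two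
-- consecutive ones, which lie in different halves, so it contains the two middle
-- entries 2m and 1, hence everything.
module EvenSimple (m₁ : ℕ) where
  m : ℕ
  m = suc m₁

  pE : ℕ → ℕ
  pE k with k <? m
  ... | yes _ = suc (k + k)
  ... | no _ = (k ∸ m) + (k ∸ m)

  qE : ℕ → ℕ
  qE v = if odd? v then ⌊ v /2⌋ else m + ⌊ v /2⌋

  qE-even : ∀ i → qE (i + i) ≡ m + i
  qE-even i rewrite odd?-even i = cong (m +_) (sym (n≡⌊n+n/2⌋ i))

  qE-odd : ∀ i → qE (suc (i + i)) ≡ i
  qE-odd i rewrite odd?-odd i = sym (n≡⌈n+n/2⌉ i)

  pE-low : ∀ {k} → k < m → pE k ≡ suc (k + k)
  pE-low {k} h with k <? m
  ... | yes _ = refl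
  ... | no k≮m = ⊥-elim (k≮m h)

  pE-high : ∀ i → pE (m + i) ≡ i + i
  pE-high i with m + i <? m
  ... | yes h = ⊥-elim (<⇒≱ h (m≤m+n m i))
  ... | no _ rewrite m+n∸m≡n m i = refl

  pE< : ∀ {k} → k < m + m → pE k < m + m
  pE< {k} h with k <? m
  ... | yes k<m = double-< k<m
  ... | no k≮m = <⇒≤ (double-< (+-cancelˡ-< m _ _ (subst (_< m + m) (sym (m+[n∸m]≡n (≮⇒≥ k≮m))) h)))

  qE< : ∀ {v} → v < m + m → qE v < m + m
  qE< {v} h with evenOdd v
  ... | even i rewrite qE-even i = +-monoʳ-< m (double-<-cancel h)
  ... | odd i rewrite qE-odd i = ≤-trans (double-<-cancel (<⇒≤ h)) (m≤m+n m m)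

  pE∘qE : ∀ {v} → v < m + m → pE (qE v) ≡ v
  pE∘qE {v} h with evenOdd v
  ... | even i rewrite qE-even i = pE-high i
  ... | odd i rewrite qE-odd i = pE-low {i} (double-<-cancel (<⇒≤ h))

  qE∘pE : ∀ {k} → k < m + m → qE (pE k) ≡ k
  qE∘pE {k} h with k <? m
  ... | yes _ = qE-odd k
  ... | no k≮m = trans (qE-even (k ∸ m)) (m+[n∸m]≡n (≮⇒≥ k≮m))

  τ : Perm (m + m)
  τ = record { p = pE ; q = qE ; p< = pE< ; q< = qE< ; p∘q = pE∘qE ; q∘p = qE∘pE }

  alternating : Alternating τ m
  alternating v h with evenOdd v
  ... | even i rewrite qE-even i | qE-odd i = inj₂ (m≤m+n m i , double-<-cancel (<⇒≤ h))
  ... | odd i rewrite qE-odd i = inj₁ (double-<-cancel (<⇒≤ (<⇒≤ h)) , subst (m ≤_) (sym q-next) (m≤m+n m (suc i)))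
    where
      q-next : qE (suc (suc (i + i))) ≡ m + suc i
      q-next = trans (cong qE (cong suc (sym (+-suc i i)))) (qE-even (suc i))

  proper-block-is-whole : ∀ {c d i j} → c < d → d < m + m → Occ τ i j c d → c ≡ 0 × suc d ≡ m + m
  proper-block-is-whole {c} {d} c<d d<n occ@(vals , _) with straddles τ alternating c<d d<n occ
  ... | s≤s i≤m₁ , m≤j = c≡0 , ≤-antisym d<n m+m≤1+d
    where
      c≡0 : c ≡ 0
      c≡0 = n≤0⇒n≡0 (subst (c ≤_) (trans (cong pE (sym (+-identityʳ m))) (pE-high 0))
                                   (proj₁ (vals m (m≤n⇒m≤1+n i≤m₁) m≤j)))
      m+m≤1+d : m + m ≤ suc d
      m+m≤1+d = subst (_≤ suc d) (cong suc (sym (+-suc m₁ m₁)))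
                  (s≤s (subst (_≤ d) (pE-low ≤-refl) (proj₂ (vals m₁ i≤m₁ (≤-trans (n≤1+n m₁) m≤j)))))

  simple : Simple τ
  simple {c} {d} (c≤d , d<n , _ , _ , _ , _ , occ) with c ≟ d
  ... | yes c≡d = inj₁ c≡d
  ... | no c≢d = inj₂ (proper-block-is-whole (≤∧≢⇒< c≤d c≢d) d<n occ)

-- 2 4 … 2m 1 (2m+1) 3 5 … 2m-1 (one-based, m ≥ 2) is simple: as above a proper
-- block contains the middle entries 2m and 1; it then contains the value 3, so
-- the entry 2m+1 between 1 and 3, hence everything.
module OddSimple (m₂ : ℕ) where
  m₁ m s : ℕ
  m₁ = suc m₂
  m = suc m₁
  s = suc (m + m)

  high : ℕ → ℕ
  high zero = zero
  high (suc zero) = m + m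
  high (suc (suc r)) = suc r + suc r

  pO : ℕ → ℕ
  pO k with k <? m
  ... | yes _ = suc (k + k)
  ... | no _ = high (k ∸ m)

  position-of-even : ℕ → ℕ
  position-of-even zero = m
  position-of-even (suc i) with suc i ≟ m
  ... | yes _ = suc m
  ... | no _ = suc (m + suc i)

  position-of-top : ∀ i → suc i ≡ m → position-of-even (suc i) ≡ suc m
  position-of-top i e with suc i ≟ m
  ... | yes _ = refl
  ... | no ne = ⊥-elim (ne e)

  position-of-inner : ∀ i → suc i ≢ m → position-of-even (suc i) ≡ suc (m + suc i)
  position-of-inner i e with suc i ≟ m
  ... | yes e′ = ⊥-elim (e e′)
  ... | no _ = refl

  qO : ℕ → ℕ
  qO v = if odd? v then ⌊ v /2⌋ else position-of-even ⌊ v /2⌋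

  qO-even : ∀ i → qO (i + i) ≡ position-of-even i
  qO-even i rewrite odd?-even i = cong position-of-even (sym (n≡⌊n+n/2⌋ i))

  qO-odd : ∀ i → qO (suc (i + i)) ≡ i
  qO-odd i rewrite odd?-odd i = sym (n≡⌈n+n/2⌉ i)

  pO-low : ∀ {k} → k < m → pO k ≡ suc (k + k)
  pO-low {k} h with k <? m
  ... | yes _ = refl
  ... | no k≮m = ⊥-elim (k≮m h)

  pO-high : ∀ r → pO (m + r) ≡ high r
  pO-high r with m + r <? m
  ... | yes h = ⊥-elim (<⇒≱ h (m≤m+n m r))
  ... | no _ rewrite m+n∸m≡n m r = refl

  m≤position-of-even : ∀ i → m ≤ position-of-even i
  m≤position-of-even zero = ≤-refl
  m≤position-of-even (suc i) with suc i ≟ m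
  ... | yes _ = n≤1+n m
  ... | no _ = ≤-trans (m≤m+n m (suc i)) (n≤1+n _)

  position-of-even< : ∀ {i} → i ≤ m → position-of-even i < s
  position-of-even< {zero} _ = s≤s (m≤m+n m m)
  position-of-even< {suc i} h with suc i ≟ m
  ... | yes _ = s≤s (s≤s (m≤n+m m m₁))
  ... | no ne = s≤s (+-monoʳ-< m (≤∧≢⇒< h ne))

  high< : ∀ {r} → r ≤ m → high r < s
  high< {zero} _ = s≤s z≤n
  high< {suc zero} _ = ≤-refl
  high< {suc (suc r)} h = ≤-trans (<⇒≤ (double-< h)) (n≤1+n _)

  half-bound : ∀ {i} → i + i < s → i ≤ m
  half-bound {i} (s≤s h) with i ≤? m
  ... | yes i≤m = i≤m
  ... | no i≰m = ⊥-elim (<⇒≱ (+-mono-< (≰⇒> i≰m) (≰⇒> i≰m)) h)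

  high-index : ∀ {k} → k < s → ¬ k < m → k ∸ m ≤ m
  high-index {k} h k≮m = +-cancelˡ-≤ m _ _ (subst (_≤ m + m) (sym (m+[n∸m]≡n (≮⇒≥ k≮m))) (≤-pred h))

  pO< : ∀ {k} → k < s → pO k < s
  pO< {k} h with k <? m
  ... | yes k<m = s≤s (<⇒≤ (double-< k<m))
  ... | no k≮m = high< (high-index h k≮m)

  qO< : ∀ {v} → v < s → qO v < s
  qO< {v} h with evenOdd v
  ... | even i rewrite qO-even i = position-of-even< (half-bound {i} h)
  ... | odd i rewrite qO-odd i = ≤-trans (double-<-cancel (≤-pred h)) (≤-trans (m≤m+n m m) (n≤1+n _))

  pO∘qO : ∀ {v} → v < s → pO (qO v) ≡ v
  pO∘qO {v} h with evenOdd v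
  ... | odd i rewrite qO-odd i = pO-low {i} (double-<-cancel (≤-pred h))
  ... | even zero = trans (cong pO (sym (+-identityʳ m))) (pO-high 0)
  ... | even (suc i) rewrite qO-even (suc i) with m ≟ suc i
  ...   | yes e rewrite position-of-top i (sym e) = trans (cong pO (+-comm 1 m)) (trans (pO-high 1) (cong₂ _+_ e e))
  ...   | no e rewrite position-of-inner i (λ x → e (sym x)) = trans (cong pO (sym (+-suc m (suc i)))) (pO-high (suc (suc i)))

  qO∘high : ∀ r → r ≤ m → qO (high r) ≡ m + r
  qO∘high zero _ = sym (+-identityʳ m)
  qO∘high (suc zero) _ rewrite qO-even m | position-of-top m₁ refl = +-comm 1 m
  qO∘high (suc (suc r)) h rewrite qO-even (suc r) with m ≟ suc r
  ... | yes e = ⊥-elim (<⇒≢ h (sym e))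
  ... | no e rewrite position-of-inner r (λ x → e (sym x)) = sym (+-suc m (suc r))

  qO∘pO : ∀ {k} → k < s → qO (pO k) ≡ k
  qO∘pO {k} h with k <? m
  ... | yes _ = qO-odd k
  ... | no k≮m = trans (qO∘high (k ∸ m) (high-index h k≮m)) (m+[n∸m]≡n (≮⇒≥ k≮m))

  τ : Perm s
  τ = record { p = pO ; q = qO ; p< = pO< ; q< = qO< ; p∘q = pO∘qO ; q∘p = qO∘pO }

  alternating : Alternating τ m
  alternating v h with evenOdd v
  ... | even i rewrite qO-even i | qO-odd i = inj₂ (m≤position-of-even i , double-<-cancel (≤-pred h))
  ... | odd i rewrite qO-odd i = inj₁ (double-<-cancel (≤-pred (<⇒≤ h)) , subst (m ≤_) (sym q-next) (m≤position-of-even (suc i)))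
    where
      q-next : qO (suc (suc (i + i))) ≡ position-of-even (suc i)
      q-next = trans (cong qO (cong suc (sym (+-suc i i)))) (qO-even (suc i))

  proper-block-is-whole : ∀ {c d i j} → c < d → d < s → Occ τ i j c d → c ≡ 0 × suc d ≡ s
  proper-block-is-whole {c} {d} {i} {j} c<d d<s occ@(vals , poss) with straddles τ alternating c<d d<s occ
  ... | s≤s i≤m₁ , m≤j = c≡0 , 1+d≡s
    where
      c≡0 : c ≡ 0
      c≡0 = n≤0⇒n≡0 (subst (c ≤_) (trans (cong pO (sym (+-identityʳ m))) (pO-high 0))
                                   (proj₁ (vals m (m≤n⇒m≤1+n i≤m₁) m≤j)))
      2≤d : 2 ≤ d
      2≤d = ≤-trans (s≤s (s≤s z≤n))
              (subst (_≤ d) (pO-low ≤-refl) (proj₂ (vals m₁ i≤m₁ (≤-trans (n≤1+n m₁) m≤j))))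
      q2 : qO 2 ≡ suc (suc m)
      q2 = trans (position-of-inner 0 (λ ())) (cong suc (+-comm m 1))
      m+2≤j : suc (suc m) ≤ j
      m+2≤j = subst (_≤ j) q2 (proj₂ (poss 2 (subst (_≤ 2) (sym c≡0) z≤n) 2≤d))
      m+m≤d : m + m ≤ d
      m+m≤d = subst (_≤ d) (trans (cong pO (+-comm 1 m)) (pO-high 1))
                (proj₂ (vals (suc m) (≤-trans i≤m₁ (≤-trans (n≤1+n m₁) (n≤1+n m))) (≤-trans (n≤1+n (suc m)) m+2≤j)))
      1+d≡s : suc d ≡ s
      1+d≡s = ≤-antisym d<s (s≤s m+m≤d)

  simple : Simple τ
  simple {c} {d} (c≤d , d<s , _ , _ , _ , _ , occ) with c ≟ d
  ... | yes c≡d = inj₁ c≡d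
  ... | no c≢d = inj₂ (proper-block-is-whole (≤∧≢⇒< c≤d c≢d) d<s occ)

simple-perm : ∀ s → 4 ≤ s → Σ (Perm s) Simple
simple-perm s h with evenOdd s
simple-perm _ (s≤s (s≤s ())) | even (suc zero)
... | even (suc (suc i)) = EvenSimple.τ (suc i) , EvenSimple.simple (suc i)
simple-perm _ (s≤s (s≤s (s≤s ()))) | odd (suc zero)
... | odd (suc (suc i)) = OddSimple.τ i , OddSimple.simple i

-- Dissections of the polygon with vertices 0, 1, …, n; the chosen diagonals
-- are given as a relation C on pairs x < y.
Side : ℕ → ℕ → ℕ → Set
Side n x y = suc x ≡ y ⊎ (x ≡ 0 × y ≡ n)

Segment : ℕ → (ℕ → ℕ → Set) → ℕ → ℕ → Set
Segment n C x y = Side n x y ⊎ C x y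

record Dissection (n : ℕ) (C : ℕ → ℕ → Set) : Set where
  field
    chosen? : ∀ x y → Dec (C x y)
    diagonal : ∀ {x y} → C x y → x < y × y ≤ n × ¬ Side n x y
    non-crossing : ∀ {a b c d} → C a b → C c d → a < c → c < b → b < d → ⊥
    no-triangle : ∀ {x y z} → x < y → y < z → z ≤ n → Segment n C x y → Segment n C y z → Segment n C x z → ⊥
    no-quadrilateral : ∀ {x y z w} → x < y → y < z → z < w → w ≤ n →
      Segment n C x y → Segment n C y z → Segment n C z w → Segment n C x w → ¬ C x z → ¬ C y w → ⊥

-- The value interval [c, d] of a permutation of size n corresponds to the
-- segment {c, d+1}: singletons to the sides {c, c+1}, the whole range to {0, n}.
SegmentOver : ℕ → (ℕ → ℕ → Set) → ℕ → ℕ → Set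
SegmentOver n C c d = c ≤ d × d < n × Segment n C c (suc d)

Realizes : ∀ {n} → Perm n → (ℕ → ℕ → Set) → Set
Realizes {n} P C = ∀ c d → Interval P c d ⇔ SegmentOver n C c d

-- Blowing the point a up into the block a, a+1, …, a+t: left and right send a
-- to the two ends of the block and shift everything above a by t; squash
-- collapses the block back to a.
module Blowup (a t₁ : ℕ) where
  t : ℕ
  t = suc t₁

  left : ℕ → ℕ
  left x with x ≤? a
  ... | yes _ = x
  ... | no _ = x + t

  right : ℕ → ℕ
  right x with x <? a
  ... | yes _ = x
  ... | no _ = x + t

  squash : ℕ → ℕ
  squash v with v ≤? a
  ... | yes _ = v
  ... | no _ with v ≤? a + t
  ...   | yes _ = a
  ...   | no _ = v ∸ t

  InBlock : ℕ → Set
  InBlock v = a ≤ v × v ≤ a + t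

  InBlock? : ∀ v → Dec (InBlock v)
  InBlock? v = (a ≤? v) ×-dec (v ≤? a + t)

  left-≤ : ∀ {x} → x ≤ a → left x ≡ x
  left-≤ {x} h with x ≤? a
  ... | yes _ = refl
  ... | no y = ⊥-elim (y h)

  left-> : ∀ {x} → a < x → left x ≡ x + t
  left-> {x} h with x ≤? a
  ... | yes y = ⊥-elim (<⇒≱ h y)
  ... | no _ = refl

  right-< : ∀ {x} → x < a → right x ≡ x
  right-< {x} h with x <? a
  ... | yes _ = refl
  ... | no y = ⊥-elim (y h)

  right-≥ : ∀ {x} → a ≤ x → right x ≡ x + t
  right-≥ {x} h with x <? a
  ... | yes y = ⊥-elim (<⇒≱ y h)
  ... | no _ = refl

  squash-≤ : ∀ {v} → v ≤ a → squash v ≡ v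
  squash-≤ {v} h with v ≤? a
  ... | yes _ = refl
  ... | no y = ⊥-elim (y h)

  squash-inside : ∀ {v} → a < v → v ≤ a + t → squash v ≡ a
  squash-inside {v} h h' with v ≤? a
  ... | yes y = ⊥-elim (<⇒≱ h y)
  ... | no _ with v ≤? a + t
  ...   | yes _ = refl
  ...   | no y = ⊥-elim (y h')

  squash-> : ∀ {v} → a + t < v → squash v ≡ v ∸ t
  squash-> {v} h with v ≤? a
  ... | yes y = ⊥-elim (<⇒≱ h (≤-trans y (m≤m+n a t)))
  ... | no _ with v ≤? a + t
  ...   | yes y = ⊥-elim (<⇒≱ h y)
  ...   | no _ = refl

  data Region (v : ℕ) : Set where
    below : v ≤ a → Region v
    inside : a < v → v ≤ a + t → Region v
    above : a + t < v → Region v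

  region : ∀ v → Region v
  region v with v ≤? a
  ... | yes x = below x
  ... | no x with v ≤? a + t
  ...   | yes y = inside (≰⇒> x) y
  ...   | no y = above (≰⇒> y)

  +<⇒<∸ : ∀ {x v} → x + t < v → x < v ∸ t
  +<⇒<∸ {x} {v} h = +-cancelʳ-≤ t (suc x) (v ∸ t) (subst (x + t <_) (sym (m∸n+n≡m (≤-trans (m≤n+m t x) (<⇒≤ h)))) h)

  ∸+-above : ∀ {v} → a + t < v → v ∸ t + t ≡ v
  ∸+-above {v} h = m∸n+n≡m (≤-trans (m≤n+m t a) (<⇒≤ h))

  squash∘left : ∀ x → squash (left x) ≡ x
  squash∘left x with x ≤? a
  ... | yes y = squash-≤ y
  ... | no y = trans (squash-> (+-monoˡ-< t (≰⇒> y))) (m+n∸n≡m x t)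

  squash∘right : ∀ x → squash (right x) ≡ x
  squash∘right x with x <? a
  ... | yes y = squash-≤ (<⇒≤ y)
  ... | no y with m≤n⇒m<n∨m≡n (≮⇒≥ y)
  ...   | inj₁ a<x = trans (squash-> (+-monoˡ-< t a<x)) (m+n∸n≡m x t)
  ...   | inj₂ refl = squash-inside (m<m+n a (s≤s z≤n)) ≤-refl

  squash≤id : ∀ v → squash v ≤ v
  squash≤id v with region v
  ... | below h = ≤-reflexive (squash-≤ h)
  ... | inside h h' = subst (_≤ v) (sym (squash-inside h h')) (<⇒≤ h)
  ... | above h = subst (_≤ v) (sym (squash-> h)) (m∸n≤m v t)

  squash-mono : ∀ {v w} → v ≤ w → squash v ≤ squash w
  squash-mono {v} {w} vw with region v | region w
  ... | below x | below y rewrite squash-≤ x | squash-≤ y = vw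
  ... | below x | inside y y' rewrite squash-≤ x | squash-inside y y' = x
  ... | below x | above y rewrite squash-≤ x | squash-> y = ≤-trans x (<⇒≤ (+<⇒<∸ y))
  ... | inside x x' | below y = ⊥-elim (<⇒≱ x (≤-trans vw y))
  ... | inside x x' | inside y y' rewrite squash-inside x x' | squash-inside y y' = ≤-refl
  ... | inside x x' | above y rewrite squash-inside x x' | squash-> y = <⇒≤ (+<⇒<∸ y)
  ... | above x | below y = ⊥-elim (<⇒≱ x (≤-trans vw (≤-trans y (m≤m+n a t))))
  ... | above x | inside y y' = ⊥-elim (<⇒≱ x (≤-trans vw y'))
  ... | above x | above y rewrite squash-> x | squash-> y = ∸-monoˡ-≤ t vw

  id≤left : ∀ x → x ≤ left x
  id≤left x with x ≤? a
  ... | yes _ = ≤-refl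
  ... | no _ = m≤m+n x t

  id≤right : ∀ x → x ≤ right x
  id≤right x with x <? a
  ... | yes _ = ≤-refl
  ... | no _ = m≤m+n x t

  left-outside : ∀ {x} → x ≢ a → ¬ InBlock (left x)
  left-outside {x} ne (h1 , h2) with x ≤? a
  ... | yes y = ne (≤-antisym y h1)
  ... | no y = <⇒≱ (+-monoˡ-< t (≰⇒> y)) h2

  squash-InBlock : ∀ {v} → InBlock v → squash v ≡ a
  squash-InBlock {v} (h1 , h2) with m≤n⇒m<n∨m≡n h1
  ... | inj₁ x = squash-inside x h2
  ... | inj₂ e = trans (cong squash (sym e)) (squash-≤ ≤-refl)

  squash-outside : ∀ {v} → ¬ InBlock v → squash v ≢ a
  squash-outside {v} nb e with region v
  ... | below x = nb (≤-reflexive (trans (sym e) (squash-≤ x)) , ≤-trans x (m≤m+n a t))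
  ... | inside x x' = nb (<⇒≤ x , x')
  ... | above x = <⇒≢ (+<⇒<∸ x) (sym (trans (sym (squash-> x)) e))

  left∘squash : ∀ {v} → ¬ InBlock v → left (squash v) ≡ v
  left∘squash {v} nb with region v
  ... | below x rewrite squash-≤ x = left-≤ x
  ... | inside x x' = ⊥-elim (nb (<⇒≤ x , x'))
  ... | above x rewrite squash-> x = trans (left-> (+<⇒<∸ x)) (∸+-above x)

  squash≤⇒≤left : ∀ {i k} → squash i ≤ k → k ≢ a → i ≤ left k
  squash≤⇒≤left {i} {k} h ne with region i
  ... | below x rewrite squash-≤ x = ≤-trans h (id≤left k)
  ... | inside x x' rewrite squash-inside x x' | left-> (≤∧≢⇒< h (λ e → ne (sym e))) =
         ≤-trans x' (+-monoˡ-≤ t h)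
  ... | above x rewrite squash-> x | left-> (<-≤-trans (+<⇒<∸ x) h) =
         subst (_≤ k + t) (∸+-above x) (+-monoˡ-≤ t h)

  ≤squash⇒left≤ : ∀ {j k} → k ≤ squash j → k ≢ a → left k ≤ j
  ≤squash⇒left≤ {j} {k} h ne with region j
  ... | below x rewrite squash-≤ x | left-≤ (≤-trans h x) = h
  ... | inside x x' rewrite squash-inside x x' | left-≤ h = ≤-trans h (<⇒≤ x)
  ... | above x rewrite squash-> x with k ≤? a
  ...   | yes y = ≤-trans h (m∸n≤m j t)
  ...   | no y = subst (k + t ≤_) (∸+-above x) (+-monoˡ-≤ t h)

  left-mono : ∀ {x y} → x ≤ y → left x ≤ left y
  left-mono {x} {y} h with x ≤? a | y ≤? a
  ... | yes _ | yes _ = h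
  ... | yes _ | no _ = ≤-trans h (m≤m+n y t)
  ... | no u | yes v = ⊥-elim (u (≤-trans h v))
  ... | no _ | no _ = +-monoˡ-≤ t h

  left≤right : ∀ {x y} → x ≤ y → left x ≤ right y
  left≤right {x} {y} h with x ≤? a
  ... | yes _ = ≤-trans h (id≤right y)
  ... | no u rewrite right-≥ (≤-trans (<⇒≤ (≰⇒> u)) h) = +-monoˡ-≤ t h

  left< : ∀ {N x} → a < N → x < N → left x < N + t
  left< {N} {x} aN xN with x ≤? a
  ... | yes _ = ≤-trans xN (m≤m+n N t)
  ... | no _ = +-monoˡ-< t xN

  right< : ∀ {N x} → a < N → x < N → right x < N + t
  right< {N} {x} aN xN with x <? a
  ... | yes _ = ≤-trans xN (m≤m+n N t)
  ... | no _ = +-monoˡ-< t xN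

  squash< : ∀ {N v} → a < N → v < N + t → squash v < N
  squash< {N} {v} aN vN with region v
  ... | below x rewrite squash-≤ x = ≤-<-trans x aN
  ... | inside x x' rewrite squash-inside x x' = aN
  ... | above x rewrite squash-> x = +-cancelʳ-≤ t (suc (v ∸ t)) N (subst (λ u → suc u ≤ N + t) (sym (∸+-above x)) vN)

  a+t≤right : ∀ {d} → a ≤ d → a + t ≤ right d
  a+t≤right h rewrite right-≥ h = +-monoˡ-≤ t h

  left∘squash-below : ∀ {v} → v ≤ a → left (squash v) ≡ v
  left∘squash-below h rewrite squash-≤ h = left-≤ h

  left∘squash-above : ∀ {v} → a + t < v → left (squash v) ≡ v
  left∘squash-above h rewrite squash-> h = trans (left-> (+<⇒<∸ h)) (∸+-above h)

  right∘squash-below : ∀ {v} → v < a → right (squash v) ≡ v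
  right∘squash-below h rewrite squash-≤ (<⇒≤ h) = right-< h

  right∘squash-above : ∀ {v} → a + t ≤ v → right (squash v) ≡ v
  right∘squash-above {v} h with m≤n⇒m<n∨m≡n h
  ... | inj₁ x rewrite squash-> x = trans (right-≥ (<⇒≤ (+<⇒<∸ x))) (∸+-above x)
  ... | inj₂ refl rewrite squash-inside (m<m+n a (s≤s z≤n)) (≤-refl {a + t}) = right-≥ ≤-refl

  squash-a : squash a ≡ a
  squash-a = squash-≤ ≤-refl

  meets-block : ∀ {i j} → squash i ≤ a → a ≤ squash j → i ≤ j → Σ ℕ λ k → i ≤ k × k ≤ j × InBlock k
  meets-block {i} {j} h1 h2 ij with region i
  ... | below x = a , x , ≤-trans h2 (squash≤id j) , ≤-refl , m≤m+n a t
  ... | inside x x' = i , ≤-refl , ij , <⇒≤ x , x'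
  ... | above x rewrite squash-> x = ⊥-elim (<⇒≱ (+<⇒<∸ x) h1)

  left-strict-mono : ∀ {x y} → x < y → left x < left y
  left-strict-mono {x} {y} h with x ≤? a | y ≤? a
  ... | yes _ | yes _ = h
  ... | yes _ | no _ = ≤-trans h (m≤m+n y t)
  ... | no x≰a | yes y≤a = ⊥-elim (x≰a (≤-trans (<⇒≤ h) y≤a))
  ... | no _ | no _ = +-monoˡ-< t h

  left-reflects-< : ∀ {x y} → left x < left y → x < y
  left-reflects-< {x} {y} h with x <? y
  ... | yes x<y = x<y
  ... | no x≮y = ⊥-elim (<⇒≱ h (left-mono (≮⇒≥ x≮y)))

  left-reflects-≤ : ∀ {x y} → left x ≤ left y → x ≤ y
  left-reflects-≤ {x} {y} h with x ≤? y
  ... | yes x≤y = x≤y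
  ... | no x≰y = ⊥-elim (<⇒≱ (left-strict-mono (≰⇒> x≰y)) h)

  left-suc : ∀ x → left (suc x) ≡ suc (right x)
  left-suc x with a ≤? x
  ... | no a≰x rewrite left-≤ (≰⇒> a≰x) | right-< (≰⇒> a≰x) = refl
  ... | yes a≤x rewrite left-> (s≤s a≤x) | right-≥ a≤x = refl

-- The positions (resp. values) of the inflation of P at position z (value a)
-- by τ: the block of positions z, …, z+t carries the values a + τ(·), the
-- other positions those of P, shifted.
inflateMap : (t₁ : ℕ) (f g : ℕ → ℕ) (a z : ℕ) → ℕ → ℕ
inflateMap t₁ f g a z k with Blowup.InBlock? z t₁ k
... | yes _ = a + g (k ∸ z)
... | no _ = Blowup.left a t₁ (f (Blowup.squash z t₁ k))

module InflateMap {N} (t₁ : ℕ) (P : Perm N) (τ : Perm (suc (suc t₁))) {a z} (z<N : z < N)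
                  (pz≡a : Perm.p P z ≡ a) where
  open Perm P renaming (p to f; q to f′; p< to f<; p∘q to f∘f′)
  open Perm τ renaming (p to g; q to g′; p< to g<; q< to g′<; p∘q to g∘g′)

  t : ℕ
  t = suc t₁

  module A = Blowup a t₁
  module Z = Blowup z t₁

  a<N : a < N
  a<N = subst (_< N) pz≡a (f< z<N)

  mix : ℕ → ℕ
  mix = inflateMap t₁ f g a z

  mix-inside : ∀ {k} → Z.InBlock k → mix k ≡ a + g (k ∸ z)
  mix-inside {k} h with Z.InBlock? k
  ... | yes _ = refl
  ... | no k∉ = ⊥-elim (k∉ h)

  mix-outside : ∀ {k} → ¬ Z.InBlock k → mix k ≡ A.left (f (Z.squash k))
  mix-outside {k} h with Z.InBlock? k
  ... | yes k∈ = ⊥-elim (h k∈)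
  ... | no _ = refl

  ∸<1+t : ∀ {v b} → v ≤ b + t → v ∸ b < suc t
  ∸<1+t {v} {b} h = s≤s (subst (v ∸ b ≤_) (m+n∸m≡n b t) (∸-monoˡ-≤ b h))

  g≤t : ∀ {k} → k < suc t → g k ≤ t
  g≤t h = ≤-pred (g< h)

  mix-InBlock : ∀ {k} → Z.InBlock k → A.InBlock (mix k)
  mix-InBlock {k} k∈ rewrite mix-inside k∈ = m≤m+n a _ , +-monoʳ-≤ a (g≤t (∸<1+t (proj₂ k∈)))

  mix< : ∀ {k} → k < N + t → mix k < N + t
  mix< {k} h with Z.InBlock? k
  ... | yes (_ , k≤z+t) = ≤-<-trans (+-monoʳ-≤ a (g≤t (∸<1+t k≤z+t))) (+-monoˡ-< t a<N)
  ... | no _ = A.left< a<N (f< (Z.squash< z<N h))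

  f′-avoids-z : ∀ {x} → x < N → x ≢ a → f′ x ≢ z
  f′-avoids-z {x} x<N x≢a e = x≢a (trans (sym (f∘f′ x<N)) (trans (cong f e) pz≡a))

  mix∘mix′ : ∀ {v} → v < N + t → mix (inflateMap t₁ f′ g′ z a v) ≡ v
  mix∘mix′ {v} h with A.InBlock? v
  ... | yes (a≤v , v≤a+t) = begin
      mix (z + g′ (v ∸ a))     ≡⟨ mix-inside (m≤m+n z _ , +-monoʳ-≤ z (≤-pred (g′< (∸<1+t v≤a+t)))) ⟩
      a + g (z + g′ (v ∸ a) ∸ z) ≡⟨ cong (λ u → a + g u) (m+n∸m≡n z _) ⟩
      a + g (g′ (v ∸ a))       ≡⟨ cong (a +_) (g∘g′ (∸<1+t v≤a+t)) ⟩
      a + (v ∸ a)              ≡⟨ m+[n∸m]≡n a≤v ⟩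
      v                        ∎
    where open ≡-Reasoning
  ... | no v∉ = begin
      mix (Z.left (f′ (A.squash v)))           ≡⟨ mix-outside (Z.left-outside (f′-avoids-z x<N (A.squash-outside v∉))) ⟩
      A.left (f (Z.squash (Z.left (f′ (A.squash v))))) ≡⟨ cong (λ u → A.left (f u)) (Z.squash∘left _) ⟩
      A.left (f (f′ (A.squash v)))             ≡⟨ cong A.left (f∘f′ x<N) ⟩
      A.left (A.squash v)                      ≡⟨ A.left∘squash v∉ ⟩
      v                                        ∎
    where
      open ≡-Reasoning
      x<N : A.squash v < N
      x<N = A.squash< a<N h

  lift-half : ∀ {i j c d} → MapsInto f i j c d → MapsInto mix (Z.left i) (Z.right j) (A.left c) (A.right d)
  lift-half {i} {j} {c} {d} H k h1 h2 with Z.InBlock? k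
  ... | yes k∈ = ≤-trans (≤-reflexive (A.left-≤ c≤a)) (≤-trans c≤a (m≤m+n a _)) ,
                 ≤-trans (+-monoʳ-≤ a (g≤t (∸<1+t (proj₂ k∈)))) (A.a+t≤right a≤d)
    where
      squash-k : Z.squash k ≡ z
      squash-k = Z.squash-InBlock k∈
      i≤z : i ≤ z
      i≤z = subst₂ _≤_ (Z.squash∘left i) squash-k (Z.squash-mono h1)
      z≤j : z ≤ j
      z≤j = subst₂ _≤_ squash-k (Z.squash∘right j) (Z.squash-mono h2)
      c≤a : c ≤ a
      c≤a = subst (c ≤_) pz≡a (proj₁ (H z i≤z z≤j))
      a≤d : a ≤ d
      a≤d = subst (_≤ d) pz≡a (proj₂ (H z i≤z z≤j))
  ... | no _ = A.left-mono (proj₁ Hk) , A.left≤right (proj₂ Hk)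
    where
      Hk = H (Z.squash k) (subst (_≤ Z.squash k) (Z.squash∘left i) (Z.squash-mono h1))
                          (subst (Z.squash k ≤_) (Z.squash∘right j) (Z.squash-mono h2))

  squash-half : ∀ {i j c d} → MapsInto mix i j c d →
    (Z.squash i ≤ z → z ≤ Z.squash j → A.squash c ≤ a × a ≤ A.squash d) →
    MapsInto f (Z.squash i) (Z.squash j) (A.squash c) (A.squash d)
  squash-half {i} {j} {c} {d} H at-z k h1 h2 with k ≟ z
  ... | yes refl = subst (λ u → A.squash c ≤ u × u ≤ A.squash d) (sym pz≡a) (at-z h1 h2)
  ... | no k≢z = subst (λ u → A.squash c ≤ u × u ≤ A.squash d) (A.squash∘left (f k))
                  (A.squash-mono (proj₁ Hk′) , A.squash-mono (proj₂ Hk′))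
    where
      Hk′ : c ≤ A.left (f k) × A.left (f k) ≤ d
      Hk′ = subst (λ u → c ≤ u × u ≤ d)
              (trans (mix-outside (Z.left-outside k≢z)) (cong (λ u → A.left (f u)) (Z.squash∘left k)))
              (H (Z.left k) (Z.squash≤⇒≤left h1 k≢z) (Z.≤squash⇒left≤ h2 k≢z))

  restrict-half : ∀ {i j c d} → z ≤ j → MapsInto mix i j c d →
    MapsInto g (i ∸ z) ((j ∸ z) ⊓ t) (c ∸ a) ((d ∸ a) ⊓ t)
  restrict-half {i} {j} {c} {d} z≤j H k h1 h2 =
      subst (c ∸ a ≤_) (m+n∸m≡n a (g k)) (∸-monoˡ-≤ a (proj₁ Hk′)) ,
      ⊓-glb (subst (_≤ d ∸ a) (m+n∸m≡n a (g k)) (∸-monoˡ-≤ a (proj₂ Hk′))) (g≤t (s≤s k≤t))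
    where
      k≤t : k ≤ t
      k≤t = ≤-trans h2 (m⊓n≤n _ _)
      i≤z+k : i ≤ z + k
      i≤z+k = ≤-trans (m≤n+m∸n i z) (+-monoʳ-≤ z h1)
      z+k≤j : z + k ≤ j
      z+k≤j = subst (z + k ≤_) (m+[n∸m]≡n z≤j) (+-monoʳ-≤ z (≤-trans h2 (m⊓n≤m _ _)))
      Hk′ : c ≤ a + g k × a + g k ≤ d
      Hk′ = subst (λ u → c ≤ u × u ≤ d)
              (trans (mix-inside (m≤m+n z k , +-monoʳ-≤ z k≤t)) (cong (λ u → a + g u) (m+n∸m≡n z k)))
              (H (z + k) i≤z+k z+k≤j)

module _ {t₂} (τ : Perm (suc (suc (suc t₂)))) (simple : Simple τ) where
  open Perm τ

  private
    t : ℕ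
    t = suc (suc t₂)

    complement-Occ : ∀ {k₀ w₀ i j c d} → p k₀ ≡ w₀ → k₀ < suc t →
      (∀ k → i ≤ k → k ≤ j → k < suc t × k ≢ k₀) → (∀ k → k < suc t → k ≢ k₀ → i ≤ k × k ≤ j) →
      (∀ v → c ≤ v → v ≤ d → v < suc t × v ≢ w₀) → (∀ v → v < suc t → v ≢ w₀ → c ≤ v × v ≤ d) →
      Occ τ i j c d
    complement-Occ {k₀} e k₀< in-pos all-pos in-val all-val =
      (λ k h1 h2 → let (k< , k≢k₀) = in-pos k h1 h2 in
                   all-val (p k) (p< k<) (λ e′ → k≢k₀ (p-injective τ k< k₀< (trans e′ (sym e))))) ,
      (λ v h1 h2 → let (v< , v≢w₀) = in-val v h1 h2 in
                   all-pos (q v) (q< v<) (λ e′ → v≢w₀ (trans (sym (p∘q v<)) (trans (cong p e′) e))))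

    upper-in : ∀ k → 1 ≤ k → k ≤ t → k < suc t × k ≢ 0
    upper-in k h1 h2 = s≤s h2 , λ e → <⇒≢ h1 (sym e)
    upper-all : ∀ k → k < suc t → k ≢ 0 → 1 ≤ k × k ≤ t
    upper-all zero _ k≢0 = ⊥-elim (k≢0 refl)
    upper-all (suc k) h _ = s≤s z≤n , ≤-pred h
    lower-in : ∀ k → 0 ≤ k → k ≤ suc t₂ → k < suc t × k ≢ t
    lower-in k _ h2 = s≤s (≤-trans h2 (n≤1+n _)) , λ e → <⇒≢ (s≤s h2) e
    lower-all : ∀ k → k < suc t → k ≢ t → 0 ≤ k × k ≤ suc t₂
    lower-all k h k≢t = z≤n , ≤-pred (≤∧≢⇒< (≤-pred h) k≢t)

    too-large : ∀ {c d} → Interval τ c d → c < d → 0 < c ⊎ d < t → ⊥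
    too-large I c<d misses-end with simple I | misses-end
    ... | inj₁ c≡d | _ = <⇒≢ c<d c≡d
    ... | inj₂ (c≡0 , _) | inj₁ 0<c = <⇒≢ 0<c (sym c≡0)
    ... | inj₂ (_ , 1+d≡1+t) | inj₂ d<t = <⇒≢ d<t (suc-injective 1+d≡1+t)

    1<t : 1 < t
    1<t = s≤s (s≤s z≤n)

  -- Otherwise the remaining t entries would form an interval.
  simple-end-not-extreme : ∀ {k₀ w₀} → (k₀ ≡ 0 ⊎ k₀ ≡ t) → (w₀ ≡ 0 ⊎ w₀ ≡ t) → p k₀ ≢ w₀
  simple-end-not-extreme (inj₁ refl) (inj₁ refl) e = too-large
    (<⇒≤ 1<t , ≤-refl , 1 , t , <⇒≤ 1<t , ≤-refl ,
     complement-Occ e (s≤s z≤n) upper-in upper-all upper-in upper-all) 1<t (inj₁ (s≤s z≤n))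
  simple-end-not-extreme (inj₁ refl) (inj₂ refl) e = too-large
    (z≤n , n≤1+n _ , 1 , t , <⇒≤ 1<t , ≤-refl ,
     complement-Occ e (s≤s z≤n) upper-in upper-all lower-in lower-all) (s≤s z≤n) (inj₂ ≤-refl)
  simple-end-not-extreme (inj₂ refl) (inj₁ refl) e = too-large
    (<⇒≤ 1<t , ≤-refl , 0 , suc t₂ , z≤n , n≤1+n _ ,
     complement-Occ e ≤-refl lower-in lower-all upper-in upper-all) 1<t (inj₁ (s≤s z≤n))
  simple-end-not-extreme (inj₂ refl) (inj₂ refl) e = too-large
    (z≤n , n≤1+n _ , 0 , suc t₂ , z≤n , n≤1+n _ ,
     complement-Occ e ≤-refl lower-in lower-all lower-in lower-all) (s≤s z≤n) (inj₂ ≤-refl)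

module Inflation {n′} (P′ : Perm n′) {a} (a<n′ : a < n′) {t₂} (τ : Perm (suc (suc (suc t₂)))) (τ-simple : Simple τ) where
  open Perm P′ using () renaming (q to q′; q< to q′<; p∘q to p′∘q′)
  open Perm τ using () renaming (q to qτ; q< to qτ<; p∘q to pτ∘qτ)

  t₁ t n z : ℕ
  t₁ = suc t₂
  t = suc t₁
  n = n′ + t
  z = q′ a

  z<n′ : z < n′
  z<n′ = q′< a<n′

  module Val = InflateMap t₁ P′ τ z<n′ (p′∘q′ a<n′)
  module Pos = InflateMap t₁ (inverse P′) (inverse τ) a<n′ refl
  module A = Blowup a t₁
  module Z = Blowup z t₁

  P : Perm n
  P = record { p = Val.mix ; q = Pos.mix ; p< = Val.mix< ; q< = Pos.mix< ; p∘q = Val.mix∘mix′ ; q∘p = Pos.mix∘mix′ }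

  lift : ∀ {c d} → Interval P′ c d → Interval P (A.left c) (A.right d)
  lift (c≤d , d<n′ , i , j , i≤j , j<n′ , vals , poss) =
    A.left≤right c≤d , A.right< a<n′ d<n′ , Z.left i , Z.right j , Z.left≤right i≤j , Z.right< z<n′ j<n′ ,
    Val.lift-half vals , Pos.lift-half poss

  Lifted : ℕ → ℕ → Set
  Lifted c d = ∃[ c′ ] ∃[ d′ ] (Interval P′ c′ d′ × c ≡ A.left c′ × d ≡ A.right d′)

  module Classify {c d i j} (c≤d : c ≤ d) (d<n : d < n) (i≤j : i ≤ j) (j<n : j < n) (occ : Occ P i j c d) where
    vals = proj₁ occ
    poss = proj₂ occ

    squashed : (Z.squash i ≤ z → z ≤ Z.squash j → A.squash c ≤ a × a ≤ A.squash d) →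
               (A.squash c ≤ a → a ≤ A.squash d → Z.squash i ≤ z × z ≤ Z.squash j) → Interval P′ (A.squash c) (A.squash d)
    squashed at-z at-a = A.squash-mono c≤d , A.squash< a<n′ d<n , Z.squash i , Z.squash j , Z.squash-mono i≤j ,
                         Z.squash< z<n′ j<n , Val.squash-half vals at-z , Pos.squash-half poss at-a

    avoiding-block : (a ≤ d → c ≤ a + t → ⊥) → Interval P′ (A.squash c) (A.squash d)
    avoiding-block avoids = squashed at-z at-a
      where
        at-z : Z.squash i ≤ z → z ≤ Z.squash j → A.squash c ≤ a × a ≤ A.squash d
        at-z h1 h2 with Z.meets-block h1 h2 i≤j
        ... | k , i≤k , k≤j , k∈ = ⊥-elim (avoids (≤-trans (proj₁ (Val.mix-InBlock k∈)) (proj₂ (vals k i≤k k≤j)))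
                                                  (≤-trans (proj₁ (vals k i≤k k≤j)) (proj₂ (Val.mix-InBlock k∈))))
        at-a : A.squash c ≤ a → a ≤ A.squash d → Z.squash i ≤ z × z ≤ Z.squash j
        at-a h1 h2 with A.meets-block h1 h2 c≤d
        ... | v , c≤v , v≤d , (a≤v , v≤a+t) = ⊥-elim (avoids (≤-trans a≤v v≤d) (≤-trans c≤v v≤a+t))

    containing-block : c ≤ a → a + t ≤ d → Lifted c d
    containing-block c≤a a+t≤d =
      A.squash c , A.squash d , squashed at-z at-a , sym (A.left∘squash-below c≤a) , sym (A.right∘squash-above a+t≤d)
      where
        a≤d : a ≤ d
        a≤d = ≤-trans (m≤m+n a t) a+t≤d
        at-z : Z.squash i ≤ z → z ≤ Z.squash j → A.squash c ≤ a × a ≤ A.squash d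
        at-z _ _ = subst (A.squash c ≤_) A.squash-a (A.squash-mono c≤a) , subst (_≤ A.squash d) A.squash-a (A.squash-mono a≤d)
        at-a : A.squash c ≤ a → a ≤ A.squash d → Z.squash i ≤ z × z ≤ Z.squash j
        at-a _ _ = subst (Z.squash i ≤_) squash-qa (Z.squash-mono (proj₁ (poss a c≤a a≤d))) ,
                   subst (_≤ Z.squash j) squash-qa (Z.squash-mono (proj₂ (poss a c≤a a≤d)))
          where
            squash-qa : Z.squash (Pos.mix a) ≡ z
            squash-qa = Z.squash-InBlock (Pos.mix-InBlock (≤-refl , m≤m+n a t))

    End : ℕ → Set
    End w = w ≡ 0 ⊎ w ≡ t

    End< : ∀ {w} → End w → w < suc t
    End< (inj₁ refl) = s≤s z≤n
    End< (inj₂ refl) = ≤-refl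

    -- An interval meeting the block of τ in a single entry of extreme value
    -- cannot reach beyond the block: that entry would sit at an end of τ.
    single-extreme-stays : ∀ {w} → End w → Occ τ (i ∸ z) ((j ∸ z) ⊓ t) (c ∸ a) ((d ∸ a) ⊓ t) →
      i ∸ z ≡ (j ∸ z) ⊓ t → c ∸ a ≤ w → w ≤ (d ∸ a) ⊓ t → ∀ y → i ≤ y → y ≤ j → ¬ Z.InBlock y → ⊥
    single-extreme-stays {w} w-end (_ , τ-poss) single h1 h2 y i≤y y≤j y∉ with z ≤? y
    ... | no z≰y = simple-end-not-extreme τ τ-simple (inj₁ qw≡0) w-end (pτ∘qτ (End< w-end))
      where
        qw≡0 : qτ w ≡ 0
        qw≡0 = n≤0⇒n≡0 (subst (qτ w ≤_) (trans (sym single) (m≤n⇒m∸n≡0 (≤-trans i≤y (<⇒≤ (≰⇒> z≰y)))))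
                                        (proj₂ (τ-poss w h1 h2)))
    ... | yes z≤y = simple-end-not-extreme τ τ-simple (inj₂ qw≡t) w-end (pτ∘qτ (End< w-end))
      where
        min≡t : (j ∸ z) ⊓ t ≡ t
        min≡t = m≥n⇒m⊓n≡n (subst (_≤ j ∸ z) (m+n∸m≡n z t)
                              (∸-monoˡ-≤ z (≤-trans (<⇒≤ (≰⇒> (λ y≤z+t → y∉ (z≤y , y≤z+t)))) y≤j)))
        qw≡t : qτ w ≡ t
        qw≡t = ≤-antisym (subst (qτ w ≤_) min≡t (proj₂ (τ-poss w h1 h2)))
                         (subst (_≤ qτ w) (trans single min≡t) (proj₁ (τ-poss w h1 h2)))

    module Meeting (a≤d : a ≤ d) (c≤a+t : c ≤ a + t) where
      witness : ∃[ v ] (c ≤ v × v ≤ d × A.InBlock v)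
      witness with a ≤? c
      ... | yes a≤c = c , ≤-refl , c≤d , a≤c , c≤a+t
      ... | no a≰c = a , <⇒≤ (≰⇒> a≰c) , a≤d , ≤-refl , m≤m+n a t

      v = proj₁ witness
      pos-v = poss v (proj₁ (proj₂ witness)) (proj₁ (proj₂ (proj₂ witness)))
      qv∈ = Pos.mix-InBlock (proj₂ (proj₂ (proj₂ witness)))

      z≤j : z ≤ j
      z≤j = ≤-trans (proj₁ qv∈) (proj₂ pos-v)

      block-Occ : Occ τ (i ∸ z) ((j ∸ z) ⊓ t) (c ∸ a) ((d ∸ a) ⊓ t)
      block-Occ = Val.restrict-half z≤j vals , Pos.restrict-half a≤d poss

      block-positions : i ∸ z ≤ (j ∸ z) ⊓ t
      block-positions =
        ⊓-glb (∸-monoˡ-≤ z i≤j) (subst (i ∸ z ≤_) (m+n∸m≡n z t) (∸-monoˡ-≤ z (≤-trans (proj₁ pos-v) (proj₂ qv∈))))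

      block-Interval : Interval τ (c ∸ a) ((d ∸ a) ⊓ t)
      block-Interval =
        ⊓-glb (∸-monoˡ-≤ a c≤d) (subst (c ∸ a ≤_) (m+n∸m≡n a t) (∸-monoˡ-≤ a c≤a+t)) , s≤s (m⊓n≤n _ _) ,
        i ∸ z , (j ∸ z) ⊓ t , block-positions , s≤s (m⊓n≤n _ _) , block-Occ

      single-position : c ∸ a ≡ (d ∸ a) ⊓ t → i ∸ z ≡ (j ∸ z) ⊓ t
      single-position single-value =
        Occ-point τ (s≤s (m⊓n≤n _ _)) block-positions
          (subst (Occ τ (i ∸ z) ((j ∸ z) ⊓ t) (c ∸ a)) (sym single-value) block-Occ)

      whole-block : c ∸ a ≡ 0 → suc ((d ∸ a) ⊓ t) ≡ suc t → Lifted c d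
      whole-block c∸a≡0 top = containing-block (m∸n≡0⇒m≤n c∸a≡0)
        (subst (a + t ≤_) (m+[n∸m]≡n a≤d) (+-monoʳ-≤ a (subst (_≤ d ∸ a) (suc-injective top) (m⊓n≤m _ _))))

      -- A longer interval meeting the block in one value leaves the block below
      -- (that value is then 0 in τ) or above (it is then t).
      single-block : c ∸ a ≡ (d ∸ a) ⊓ t → c ≡ d
      single-block single-value with c ≟ d
      ... | yes c≡d = c≡d
      ... | no c≢d with c <? a
      ...   | yes c<a = ⊥-elim (single-extreme-stays (inj₁ refl) block-Occ (single-position single-value) (≤-reflexive (m≤n⇒m∸n≡0 (<⇒≤ c<a))) z≤n
                                  (Pos.mix c) (proj₁ (poss c ≤-refl c≤d)) (proj₂ (poss c ≤-refl c≤d)) qc∉)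
        where
          qc∉ : ¬ Z.InBlock (Pos.mix c)
          qc∉ qc∈ = <⇒≱ c<a (subst (a ≤_) (Val.mix∘mix′ (≤-<-trans c≤d d<n)) (proj₁ (Val.mix-InBlock qc∈)))
      ...   | no c≮a with d ≤? a + t
      ...     | yes d≤a+t = ⊥-elim (c≢d (begin
                  c                   ≡⟨ sym (m+[n∸m]≡n (≮⇒≥ c≮a)) ⟩
                  a + (c ∸ a)         ≡⟨ cong (a +_) (trans single-value (m≤n⇒m⊓n≡m d∸a≤t)) ⟩
                  a + (d ∸ a)         ≡⟨ m+[n∸m]≡n a≤d ⟩
                  d                   ∎))
        where
          open ≡-Reasoning
          d∸a≤t : d ∸ a ≤ t
          d∸a≤t = subst (d ∸ a ≤_) (m+n∸m≡n a t) (∸-monoˡ-≤ a d≤a+t)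
      ...     | no d≰a+t = ⊥-elim (single-extreme-stays (inj₂ refl) block-Occ (single-position single-value)
                                    (≤-reflexive (trans single-value min≡t)) (≤-reflexive (sym min≡t))
                                    (Pos.mix d) (proj₁ (poss d c≤d ≤-refl)) (proj₂ (poss d c≤d ≤-refl)) qd∉)
        where
          min≡t : (d ∸ a) ⊓ t ≡ t
          min≡t = m≥n⇒m⊓n≡n (subst (_≤ d ∸ a) (m+n∸m≡n a t) (∸-monoˡ-≤ a (<⇒≤ (≰⇒> d≰a+t))))
          qd∉ : ¬ Z.InBlock (Pos.mix d)
          qd∉ qd∈ = d≰a+t (subst (_≤ a + t) (Val.mix∘mix′ d<n) (proj₂ (Val.mix-InBlock qd∈)))

      classify : c ≡ d ⊎ Lifted c d
      classify with τ-simple block-Interval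
      ... | inj₁ single-value = inj₁ (single-block single-value)
      ... | inj₂ (c∸a≡0 , top) = inj₂ (whole-block c∸a≡0 top)

    classify : c ≡ d ⊎ Lifted c d
    classify with d <? a
    ... | yes d<a = inj₂ (A.squash c , A.squash d , avoiding-block (λ a≤d _ → <⇒≱ d<a a≤d) ,
                          sym (A.left∘squash-below (≤-trans c≤d (<⇒≤ d<a))) , sym (A.right∘squash-below d<a))
    ... | no d≮a with a + t <? c
    ...   | yes a+t<c = inj₂ (A.squash c , A.squash d , avoiding-block (λ _ c≤a+t → <⇒≱ a+t<c c≤a+t) ,
                               sym (A.left∘squash-above a+t<c) , sym (A.right∘squash-above (<⇒≤ (<-≤-trans a+t<c c≤d))))
    ...   | no a+t≮c = Meeting.classify (≮⇒≥ d≮a) (≮⇒≥ a+t≮c)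

  classify : ∀ {c d} → Interval P c d → c ≡ d ⊎ Lifted c d
  classify (c≤d , d<n , _ , _ , i≤j , j<n , occ) = Classify.classify c≤d d<n i≤j j<n occ

simple-realizes-empty : ∀ {n} (τ : Perm n) → Simple τ → ∀ C → (∀ x y → ¬ C x y) → Realizes τ C
simple-realizes-empty τ simple C none c d = mk⇔ to from
  where
    to : Interval τ c d → SegmentOver _ C c d
    to I@(c≤d , d<n , _) with simple I
    ... | inj₁ c≡d = c≤d , d<n , inj₁ (inj₁ (cong suc c≡d))
    ... | inj₂ whole = c≤d , d<n , inj₁ (inj₂ whole)
    from : SegmentOver _ C c d → Interval τ c d
    from (c≤d , d<n , inj₁ (inj₁ e)) = subst (Interval τ c) (suc-injective e) (singleton-Interval τ (≤-<-trans c≤d d<n))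
    from (_ , _ , inj₁ (inj₂ (refl , e))) = whole-Interval τ e
    from (_ , _ , inj₂ chosen) = ⊥-elim (none _ _ chosen)

module Innermost {n C} (D : Dissection n C) where
  open Dissection D

  Innermost : ℕ → ℕ → Set
  Innermost a b = C a b × (∀ {x y} → C x y → a ≤ x → y ≤ b → x ≡ a × y ≡ b)

  private
    StrictlyInside : ℕ → ℕ → ℕ → ℕ → Set
    StrictlyInside x₀ y₀ x y = C x y × x₀ ≤ x × y ≤ y₀ × ¬ (x ≡ x₀ × y ≡ y₀)

    StrictlyInside? : ∀ x₀ y₀ x y → Dec (StrictlyInside x₀ y₀ x y)
    StrictlyInside? x₀ y₀ x y = chosen? x y ×-dec (x₀ ≤? x ×-dec (y ≤? y₀ ×-dec ¬? ((x ≟ x₀) ×-dec (y ≟ y₀))))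

    shorter : ∀ {x₀ y₀ x y} → x₀ ≤ x → x < y → y ≤ y₀ → ¬ (x ≡ x₀ × y ≡ y₀) → y ∸ x < y₀ ∸ x₀
    shorter {x₀} h1 h2 h3 ne with m≤n⇒m<n∨m≡n h1
    ... | inj₁ x₀<x = <-≤-trans (∸-monoʳ-< x₀<x (<⇒≤ h2)) (∸-monoˡ-≤ x₀ h3)
    ... | inj₂ refl with m≤n⇒m<n∨m≡n h3
    ...   | inj₁ y<y₀ = ∸-monoˡ-< y<y₀ (<⇒≤ h2)
    ...   | inj₂ refl = ⊥-elim (ne (refl , refl))

    innermost-within : ∀ fuel {x₀ y₀} → y₀ ∸ x₀ ≤ fuel → C x₀ y₀ → ∃[ a ] ∃[ b ] Innermost a b
    innermost-within zero {x₀} {y₀} h c₀ = ⊥-elim (<⇒≱ (∸-monoˡ-< (proj₁ (diagonal c₀)) (≤-refl {x₀}))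
                                                   (subst (y₀ ∸ x₀ ≤_) (sym (n∸n≡0 x₀)) h))
    innermost-within (suc fuel) {x₀} {y₀} h c₀
      with anyUpTo? (λ x → anyUpTo? (StrictlyInside? x₀ y₀ x) (suc y₀)) (suc y₀)
    ... | yes (x , _ , y , _ , (c , h1 , h3 , ne)) =
          innermost-within fuel (≤-pred (≤-trans (shorter h1 (proj₁ (diagonal c)) h3 ne) h)) c
    ... | no nothing-inside = x₀ , y₀ , c₀ , only
      where
        only : ∀ {x y} → C x y → x₀ ≤ x → y ≤ y₀ → x ≡ x₀ × y ≡ y₀
        only {x} {y} c h1 h3 with x ≟ x₀ | y ≟ y₀
        ... | yes e1 | yes e2 = e1 , e2
        ... | no ne | _ = ⊥-elim (nothing-inside (x , s≤s (≤-trans (<⇒≤ (proj₁ (diagonal c))) h3) , y , s≤s h3 ,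
                                                 c , h1 , h3 , λ e → ne (proj₁ e)))
        ... | _ | no ne = ⊥-elim (nothing-inside (x , s≤s (≤-trans (<⇒≤ (proj₁ (diagonal c))) h3) , y , s≤s h3 ,
                                                 c , h1 , h3 , λ e → ne (proj₂ e)))

  innermost : ∀ {x y} → C x y → ∃[ a ] ∃[ b ] Innermost a b
  innermost c = innermost-within _ ≤-refl c

  -- Nothing is chosen strictly inside an innermost diagonal, so it spans at
  -- least four sides: one, two or three would give a side, triangle or quadrilateral.
  innermost-wide : ∀ {a b} → Innermost a b → ∃[ t₂ ] b ≡ a + suc (suc (suc (suc t₂)))
  innermost-wide {a} {b} (cab , only) with diagonal cab
  ... | a<b , b≤n , not-side = by-width (b ∸ a) (sym (m+[n∸m]≡n (<⇒≤ a<b)))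
    where
      by-width : ∀ r → b ≡ a + r → ∃[ t₂ ] b ≡ a + suc (suc (suc (suc t₂)))
      by-width zero e = ⊥-elim (<⇒≢ a<b (trans (sym (+-identityʳ a)) (sym e)))
      by-width (suc zero) e = ⊥-elim (not-side (inj₁ (sym (trans e (+-comm a 1)))))
      by-width (suc (suc zero)) e = ⊥-elim (no-triangle (n<1+n a) (n<1+n (suc a)) (subst (_≤ n) e2 b≤n)
                                    (inj₁ (inj₁ refl)) (inj₁ (inj₁ refl)) (inj₂ (subst (C a) e2 cab)))
        where e2 : b ≡ suc (suc a)
              e2 = trans e (+-comm a 2)
      by-width (suc (suc (suc zero))) e = ⊥-elim (no-quadrilateral (n<1+n a) (n<1+n (suc a)) (n<1+n (suc (suc a))) (subst (_≤ n) e3 b≤n)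
                                    (inj₁ (inj₁ refl)) (inj₁ (inj₁ refl)) (inj₁ (inj₁ refl)) (inj₂ (subst (C a) e3 cab)) n1 n2)
        where e3 : b ≡ suc (suc (suc a))
              e3 = trans e (+-comm a 3)
              n1 : ¬ C a (suc (suc a))
              n1 c = <⇒≢ (n<1+n (suc (suc a))) (trans (proj₂ (only c ≤-refl (subst (suc (suc a) ≤_) (sym e3) (n≤1+n _)))) e3)
              n2 : ¬ C (suc a) (suc (suc (suc a)))
              n2 c = <⇒≢ (n<1+n a) (sym (proj₁ (only c (n≤1+n a) (≤-reflexive (sym e3)))))
      by-width (suc (suc (suc (suc r)))) e = r , e

-- Contracting an innermost diagonal {a, a+t+1}: the vertices a+1, …, a+t
-- disappear and the diagonal becomes the side {a, a+1}.
module Contraction (n′ t₂ a : ℕ) {C : ℕ → ℕ → Set} (D : Dissection (n′ + suc (suc (suc t₂))) C)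
                   (inner : Innermost.Innermost D a (a + suc (suc (suc (suc t₂))))) where
  open Dissection D

  t₁ t n b : ℕ
  t₁ = suc (suc t₂)
  t = suc t₁
  n = n′ + t
  b = a + suc t

  module A = Blowup a t₁

  ι : ℕ → ℕ
  ι = A.left

  C′ : ℕ → ℕ → Set
  C′ x y = C (ι x) (ι y) × ¬ (x ≡ a × y ≡ suc a)

  cab : C a b
  cab = proj₁ inner

  ι-a : ι a ≡ a
  ι-a = A.left-≤ ≤-refl

  ι-1+a : ι (suc a) ≡ b
  ι-1+a = trans (A.left-> (n<1+n a)) (sym (+-suc a t))

  a<n′ : a < n′
  a<n′ = +-cancelʳ-≤ t (suc a) n′ (subst (_≤ n′ + t) (+-suc a t) (proj₁ (proj₂ (diagonal cab))))

  ι-n′ : ι n′ ≡ n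
  ι-n′ = A.left-> a<n′

  ι-≤n : ∀ {y} → y ≤ n′ → ι y ≤ n
  ι-≤n {y} h = subst (ι y ≤_) ι-n′ (A.left-mono h)

  ι-≤n-reflect : ∀ {y} → ι y ≤ n → y ≤ n′
  ι-≤n-reflect {y} h = A.left-reflects-≤ (subst (ι y ≤_) (sym ι-n′) h)

  ι-side : ∀ {x y} → Side n′ x y → ¬ (x ≡ a × y ≡ suc a) → Side n (ι x) (ι y)
  ι-side {x} (inj₁ refl) not-ab with <-cmp x a
  ... | tri< x<a _ _ rewrite A.left-≤ (<⇒≤ x<a) | A.left-≤ x<a = inj₁ refl
  ... | tri≈ _ x≡a _ = ⊥-elim (not-ab (x≡a , cong suc x≡a))
  ... | tri> _ _ a<x rewrite A.left-> a<x | A.left-> (≤-trans a<x (n≤1+n x)) = inj₁ refl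
  ι-side (inj₂ (refl , refl)) _ = inj₂ (A.left-≤ z≤n , ι-n′)

  ι-segment : ∀ {x y} → Segment n′ C′ x y → Segment n C (ι x) (ι y)
  ι-segment (inj₂ (c , _)) = inj₂ c
  ι-segment {x} {y} (inj₁ side) with x ≟ a | y ≟ suc a
  ... | yes refl | yes refl = inj₂ (subst₂ C (sym ι-a) (sym ι-1+a) cab)
  ... | no x≢a | _ = inj₁ (ι-side side (λ e → x≢a (proj₁ e)))
  ... | _ | no y≢1+a = inj₁ (ι-side side (λ e → y≢1+a (proj₂ e)))

  shortcut-not-chosen : ∀ {x y z} → x < y → y < z → ¬ (x ≡ a × z ≡ suc a)
  shortcut-not-chosen x<y y<z (refl , refl) = <⇒≱ x<y (≤-pred y<z)

  contracted : Dissection n′ C′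
  contracted = record
    { chosen? = λ x y → chosen? (ι x) (ι y) ×-dec ¬? ((x ≟ a) ×-dec (y ≟ suc a))
    ; diagonal = λ { (c , not-ab) → let (x<y , y≤n , not-side) = diagonal c in
        A.left-reflects-< x<y , ι-≤n-reflect y≤n , λ side → not-side (ι-side side not-ab) }
    ; non-crossing = λ c1 c2 h1 h2 h3 →
        non-crossing (proj₁ c1) (proj₁ c2) (A.left-strict-mono h1) (A.left-strict-mono h2) (A.left-strict-mono h3)
    ; no-triangle = λ h1 h2 h3 s1 s2 s3 →
        no-triangle (A.left-strict-mono h1) (A.left-strict-mono h2) (ι-≤n h3) (ι-segment s1) (ι-segment s2) (ι-segment s3)
    ; no-quadrilateral = λ h1 h2 h3 h4 s1 s2 s3 s4 n1 n2 →
        no-quadrilateral (A.left-strict-mono h1) (A.left-strict-mono h2) (A.left-strict-mono h3) (ι-≤n h4)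
          (ι-segment s1) (ι-segment s2) (ι-segment s3) (ι-segment s4)
          (λ c → n1 (c , shortcut-not-chosen h1 h2)) (λ c → n2 (c , shortcut-not-chosen h2 h3))
    }

  endpoints-outside : ∀ {c e} → ¬ (c ≡ a × e ≡ b) → C c e → (c ≤ a ⊎ b ≤ c) × (e ≤ a ⊎ b ≤ e)
  endpoints-outside {c} {e} not-ab cce with c ≤? a | e ≤? a | b ≤? c | b ≤? e
  ... | yes c≤a | yes e≤a | _ | _ = inj₁ c≤a , inj₁ e≤a
  ... | yes c≤a | no _ | _ | yes b≤e = inj₁ c≤a , inj₂ b≤e
  ... | _ | _ | yes b≤c | _ = inj₂ b≤c , inj₂ (≤-trans b≤c (<⇒≤ (proj₁ (diagonal cce))))
  ... | yes c≤a | no e≰a | _ | no b≰e with m≤n⇒m<n∨m≡n c≤a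
  ...   | inj₁ c<a = ⊥-elim (non-crossing cce cab c<a (≰⇒> e≰a) (≰⇒> b≰e))
  ...   | inj₂ c≡a = ⊥-elim (not-ab (proj₂ inner cce (≤-reflexive (sym c≡a)) (<⇒≤ (≰⇒> b≰e))))
  endpoints-outside {c} {e} not-ab cce | no c≰a | _ | no b≰c | _ with e ≤? b
  ... | yes e≤b = ⊥-elim (c≰a (≤-reflexive (proj₁ (proj₂ inner cce (<⇒≤ (≰⇒> c≰a)) e≤b))))
  ... | no e≰b = ⊥-elim (non-crossing cab cce (≰⇒> c≰a) (≰⇒> b≰c) (≰⇒> e≰b))

  ι-squash : ∀ {c} → c ≤ a ⊎ b ≤ c → ι (A.squash c) ≡ c
  ι-squash (inj₁ c≤a) = A.left∘squash-below c≤a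
  ι-squash {c} (inj₂ b≤c) = A.left∘squash-above (subst (_≤ c) (+-suc a t) b≤c)

  module Inflate (P′ : Perm n′) (R′ : Realizes P′ C′) where
    τ = simple-perm (suc t) (s≤s (s≤s (s≤s (s≤s z≤n))))
    module I = Inflation P′ a<n′ (proj₁ τ) (proj₂ τ)

    to : ∀ {c d} → Interval I.P c d → SegmentOver n C c d
    to {c} {d} I@(c≤d , d<n , _) with I.classify I
    ... | inj₁ c≡d = c≤d , d<n , inj₁ (inj₁ (cong suc c≡d))
    ... | inj₂ (c′ , d′ , I′ , refl , refl) with Equivalence.to (R′ c′ d′) I′
    ...   | (_ , _ , seg′) = c≤d , d<n , subst (Segment n C (ι c′)) (A.left-suc d′) (ι-segment seg′)

    lift-diagonal : ∀ {c d} → ¬ (c ≡ a × suc d ≡ b) → suc d ≤ n → C c (suc d) → Interval I.P c d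
    lift-diagonal {c} {d} not-ab 1+d≤n cd with endpoints-outside not-ab cd
    ... | c-out , 1+d-out = subst₂ (Interval I.P) ι-c′ (suc-injective (trans (sym (A.left-suc d′)) ι-1+d′)) (I.lift I′)
      where
        c′ y′ d′ : ℕ
        c′ = A.squash c
        y′ = A.squash (suc d)
        d′ = pred y′
        ι-c′ : ι c′ ≡ c
        ι-c′ = ι-squash c-out
        c′<y′ : c′ < y′
        c′<y′ = A.left-reflects-< (subst₂ _<_ (sym ι-c′) (sym (ι-squash 1+d-out)) (proj₁ (diagonal cd)))
        1+d′≡y′ : suc d′ ≡ y′
        1+d′≡y′ = suc-pred y′ ⦃ >-nonZero (≤-<-trans z≤n c′<y′) ⦄
        ι-1+d′ : ι (suc d′) ≡ suc d
        ι-1+d′ = trans (cong ι 1+d′≡y′) (ι-squash 1+d-out)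
        C′-c′-1+d′ : C′ c′ (suc d′)
        C′-c′-1+d′ = subst₂ C (sym ι-c′) (sym ι-1+d′) cd ,
                     λ { (c′≡a , 1+d′≡1+a) → not-ab (trans (sym ι-c′) (trans (cong ι c′≡a) ι-a) ,
                                                       trans (sym ι-1+d′) (trans (cong ι 1+d′≡1+a) ι-1+a)) }
        I′ : Interval P′ c′ d′
        I′ = Equivalence.from (R′ c′ d′)
               (≤-pred (subst (c′ <_) (sym 1+d′≡y′) c′<y′) , ι-≤n-reflect (subst (_≤ n) (sym ι-1+d′) 1+d≤n) , inj₂ C′-c′-1+d′)

    from : ∀ {c d} → SegmentOver n C c d → Interval I.P c d
    from {c} {d} (c≤d , d<n , inj₁ (inj₁ e)) = subst (Interval I.P c) (suc-injective e) (singleton-Interval I.P (≤-<-trans c≤d d<n))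
    from (_ , _ , inj₁ (inj₂ (refl , e))) = whole-Interval I.P e
    from {c} {d} (c≤d , d<n , inj₂ cd) with c ≟ a | suc d ≟ b
    ... | yes refl | yes 1+d≡b =
          subst₂ (Interval I.P) ι-a (trans (A.right-≥ ≤-refl) (suc-injective (trans (sym (+-suc a t)) (sym 1+d≡b))))
                 (I.lift (singleton-Interval P′ a<n′))
    ... | no c≢a | _ = lift-diagonal (λ e → c≢a (proj₁ e)) d<n cd
    ... | yes _ | no 1+d≢b = lift-diagonal (λ e → 1+d≢b (proj₂ e)) d<n cd

    realizes : Realizes I.P C
    realizes c d = mk⇔ to from

Realizable : ℕ → (ℕ → ℕ → Set) → Set
Realizable n C = Σ (Perm n) λ P → Realizes P C

without-diagonals-realizable : ∀ {n C} → 1 ≤ n → Dissection n C → (∀ x y → ¬ C x y) → Realizable n C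
without-diagonals-realizable {suc zero} {C} _ _ none = identity₁ , simple-realizes-empty identity₁ identity₁-simple C none
without-diagonals-realizable {suc (suc zero)} _ D _ = ⊥-elim (Dissection.no-triangle D {0} {1} {2}
  (s≤s z≤n) ≤-refl ≤-refl (inj₁ (inj₁ refl)) (inj₁ (inj₁ refl)) (inj₁ (inj₂ (refl , refl))))
without-diagonals-realizable {suc (suc (suc zero))} _ D none = ⊥-elim (Dissection.no-quadrilateral D {0} {1} {2} {3}
  (s≤s z≤n) ≤-refl ≤-refl ≤-refl (inj₁ (inj₁ refl)) (inj₁ (inj₁ refl)) (inj₁ (inj₁ refl)) (inj₁ (inj₂ (refl , refl)))
  (none 0 2) (none 1 3))
without-diagonals-realizable {n@(suc (suc (suc (suc _))))} {C} _ _ none with simple-perm n (s≤s (s≤s (s≤s (s≤s z≤n))))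
... | τ , simple = τ , simple-realizes-empty τ simple C none

realizable : ∀ n {C} → 1 ≤ n → Dissection n C → Realizable n C
realizable = <-rec _ step
  where
    step : ∀ n → (∀ {n′} → n′ < n → ∀ {C} → 1 ≤ n′ → Dissection n′ C → Realizable n′ C) →
           ∀ {C} → 1 ≤ n → Dissection n C → Realizable n C
    step n rec {C} 1≤n D with anyUpTo? (λ x → anyUpTo? (λ y → Dissection.chosen? D x y) (suc n)) (suc n)
    ... | no none = without-diagonals-realizable 1≤n D λ x y c →
            let (x<y , y≤n , _) = Dissection.diagonal D c in none (x , s≤s (≤-trans (<⇒≤ x<y) y≤n) , y , s≤s y≤n , c)
    ... | yes (_ , _ , _ , _ , c) with Innermost.innermost D c
    ...   | a , b , inner with Innermost.innermost-wide D inner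
    ...     | t₂ , refl with n ∸ suc (suc (suc t₂)) | m∸n+n≡m (≤-trans (n≤1+n _) (≤-trans (m≤n+m _ a)
                                                       (proj₁ (proj₂ (Dissection.diagonal D (proj₁ inner))))))
    ...       | n′ | refl = Inflate.I.P P′ R′ , Inflate.realizes P′ R′
      where
        open Contraction n′ t₂ a D inner
        P′R′ = rec (m<m+n n′ (s≤s z≤n)) (≤-trans (s≤s z≤n) a<n′) contracted
        P′ = proj₁ P′R′
        R′ = proj₂ P′R′

Block : ∀ {n} → Perm n → ℕ → ℕ → Set
Block {n} P i j = i ≤ j × j < n × Σ ℕ λ a0 → Σ ℕ λ b0 → b0 < n × Occ P i j a0 b0

SumAt : (ℕ → ℕ → Set) → ∀ {n} → Perm n → ℕ → ℕ → Set
SumAt R P i j = ∃[ m ] (i ≤ m × m < j × (∀ k l → i ≤ k → k ≤ m → m < l → l ≤ j → R (Perm.p P k) (Perm.p P l)))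

Direct Skew : ∀ {n} → Perm n → ℕ → ℕ → Set
Direct = SumAt _<_
Skew = SumAt _>_

BWSimple : ∀ {n} → Perm n → Set
BWSimple P = ∀ i j → Block P i j → ¬ (Direct P i j ⊎ Skew P i j)

-- In a block-wise simple permutation, a part of an interval X holding its
-- lowest (or highest) values contains neither the first nor the last entry of
-- X: it would be a prefix or suffix of X, making X a direct or skew sum.
module Parts {n} (P : Perm n) (B : BWSimple P) {i j a₀ b₀} (i≤j : i ≤ j) (j<n : j < n) (b₀<n : b₀ < n)
             (occ : Occ P i j a₀ b₀) where
  open Perm P

  block : Block P i j
  block = i≤j , j<n , a₀ , b₀ , b₀<n , occ

  position-within : ∀ {i′ j′ u w l} → Occ P i′ j′ u w → l ≤ j → u ≤ p l → p l ≤ w → i′ ≤ l × l ≤ j′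
  position-within {l = l} occ′ l≤j u≤pl pl≤w =
    subst (λ x → _ ≤ x × x ≤ _) (q∘p (≤-<-trans l≤j j<n)) (proj₂ occ′ (p l) u≤pl pl≤w)

  first-value : a₀ ≤ p i × p i ≤ b₀
  first-value = proj₁ occ i ≤-refl i≤j

  last-value : a₀ ≤ p j × p j ≤ b₀
  last-value = proj₁ occ j i≤j ≤-refl

  a₀≤b₀ : a₀ ≤ b₀
  a₀≤b₀ = ≤-trans (proj₁ first-value) (proj₂ first-value)

  no-low-prefix : ∀ {j′ w} → i ≤ j′ → j′ < j → Occ P i j′ a₀ w → ⊥
  no-low-prefix {j′} {w} h1 h2 occ′ = B i j block (inj₁ (j′ , h1 , h2 , below))
    where
      below : ∀ k l → i ≤ k → k ≤ j′ → j′ < l → l ≤ j → p k < p l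
      below k l i≤k k≤j′ j′<l l≤j with p l ≤? w
      ... | yes pl≤w = ⊥-elim (<⇒≱ j′<l (proj₂ (position-within occ′ l≤j
                          (proj₁ (proj₁ occ l (≤-trans i≤k (≤-trans k≤j′ (<⇒≤ j′<l))) l≤j)) pl≤w)))
      ... | no pl≰w = ≤-<-trans (proj₂ (proj₁ occ′ k i≤k k≤j′)) (≰⇒> pl≰w)

  no-high-prefix : ∀ {j′ u} → i ≤ j′ → j′ < j → Occ P i j′ u b₀ → ⊥
  no-high-prefix {j′} {u} h1 h2 occ′ = B i j block (inj₂ (j′ , h1 , h2 , above))
    where
      above : ∀ k l → i ≤ k → k ≤ j′ → j′ < l → l ≤ j → p l < p k
      above k l i≤k k≤j′ j′<l l≤j with u ≤? p l
      ... | yes u≤pl = ⊥-elim (<⇒≱ j′<l (proj₂ (position-within occ′ l≤j u≤pl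
                          (proj₂ (proj₁ occ l (≤-trans i≤k (≤-trans k≤j′ (<⇒≤ j′<l))) l≤j)))))
      ... | no u≰pl = <-≤-trans (≰⇒> u≰pl) (proj₁ (proj₁ occ′ k i≤k k≤j′))

  no-low-suffix : ∀ {i′ w} → i < i′ → i′ ≤ j → Occ P i′ j a₀ w → ⊥
  no-low-suffix {suc m} {w} h1 h2 occ′ = B i j block (inj₂ (m , ≤-pred h1 , h2 , above))
    where
      above : ∀ k l → i ≤ k → k ≤ m → m < l → l ≤ j → p l < p k
      above k l i≤k k≤m m<l l≤j with p k ≤? w
      ... | yes pk≤w = ⊥-elim (<⇒≱ (s≤s k≤m) (proj₁ (position-within occ′ k≤j (proj₁ (proj₁ occ k i≤k k≤j)) pk≤w)))
        where k≤j = ≤-trans k≤m (≤-trans (n≤1+n m) h2)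
      ... | no pk≰w = ≤-<-trans (proj₂ (proj₁ occ′ l m<l l≤j)) (≰⇒> pk≰w)

  no-high-suffix : ∀ {i′ u} → i < i′ → i′ ≤ j → Occ P i′ j u b₀ → ⊥
  no-high-suffix {suc m} {u} h1 h2 occ′ = B i j block (inj₁ (m , ≤-pred h1 , h2 , below))
    where
      below : ∀ k l → i ≤ k → k ≤ m → m < l → l ≤ j → p k < p l
      below k l i≤k k≤m m<l l≤j with u ≤? p k
      ... | yes u≤pk = ⊥-elim (<⇒≱ (s≤s k≤m) (proj₁ (position-within occ′ k≤j u≤pk (proj₂ (proj₁ occ k i≤k k≤j)))))
        where k≤j = ≤-trans k≤m (≤-trans (n≤1+n m) h2)
      ... | no u≰pk = <-≤-trans (≰⇒> u≰pk) (proj₁ (proj₁ occ′ l m<l l≤j))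

  part-positions : ∀ {i′ j′ u w} → i′ ≤ j′ → j′ < n → Occ P i′ j′ u w → a₀ ≤ u → w ≤ b₀ → i ≤ i′ × j′ ≤ j
  part-positions {i′} {j′} h1 h2 occ′ a₀≤u w≤b₀ = i≤i′ , j′≤j
    where
      first = proj₁ occ′ i′ ≤-refl h1
      last = proj₁ occ′ j′ h1 ≤-refl
      i≤i′ = subst (i ≤_) (q∘p (≤-<-trans h1 h2)) (proj₁ (proj₂ occ (p i′) (≤-trans a₀≤u (proj₁ first)) (≤-trans (proj₂ first) w≤b₀)))
      j′≤j = subst (_≤ j) (q∘p h2) (proj₂ (proj₂ occ (p j′) (≤-trans a₀≤u (proj₁ last)) (≤-trans (proj₂ last) w≤b₀)))

  low-part-misses-ends : ∀ {i′ j′ w} → i′ ≤ j′ → j′ < n → Occ P i′ j′ a₀ w → w < b₀ → ¬ p i ≤ w × ¬ p j ≤ w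
  low-part-misses-ends {i′} {j′} {w} h1 h2 occ′ w<b₀ = misses-first , misses-last
    where
      within = part-positions h1 h2 occ′ ≤-refl (<⇒≤ w<b₀)
      not-everything : i′ ≤ i → j ≤ j′ → ⊥
      not-everything i′≤i j≤j′ = <⇒≱ w<b₀ (subst (_≤ w) (p∘q b₀<n)
        (proj₂ (proj₁ occ′ (q b₀) (≤-trans i′≤i (proj₁ pos-b₀)) (≤-trans (proj₂ pos-b₀) j≤j′))))
        where pos-b₀ = proj₂ occ b₀ a₀≤b₀ ≤-refl
      misses-first : ¬ p i ≤ w
      misses-first pi≤w with position-within occ′ i≤j (proj₁ first-value) pi≤w | m≤n⇒m<n∨m≡n (proj₂ within)
      ... | i′≤i , _ | inj₂ j′≡j = not-everything i′≤i (≤-reflexive (sym j′≡j))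
      ... | i′≤i , _ | inj₁ j′<j = no-low-prefix h1′ j′<j (subst (λ x → Occ P x j′ a₀ w) (≤-antisym i′≤i (proj₁ within)) occ′)
        where h1′ = subst (_≤ j′) (≤-antisym i′≤i (proj₁ within)) h1
      misses-last : ¬ p j ≤ w
      misses-last pj≤w with position-within occ′ ≤-refl (proj₁ last-value) pj≤w | m≤n⇒m<n∨m≡n (proj₁ within)
      ... | _ , j≤j′ | inj₂ i≡i′ = not-everything (≤-reflexive (sym i≡i′)) j≤j′
      ... | _ , j≤j′ | inj₁ i<i′ = no-low-suffix i<i′ (≤-trans h1 (proj₂ within))
                                     (subst (λ x → Occ P i′ x a₀ w) (≤-antisym (proj₂ within) j≤j′) occ′)

  high-part-misses-ends : ∀ {i′ j′ u} → i′ ≤ j′ → j′ < n → Occ P i′ j′ u b₀ → a₀ < u → ¬ u ≤ p i × ¬ u ≤ p j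
  high-part-misses-ends {i′} {j′} {u} h1 h2 occ′ a₀<u = misses-first , misses-last
    where
      within = part-positions h1 h2 occ′ (<⇒≤ a₀<u) ≤-refl
      not-everything : i′ ≤ i → j ≤ j′ → ⊥
      not-everything i′≤i j≤j′ = <⇒≱ a₀<u (subst (u ≤_) (p∘q (≤-<-trans a₀≤b₀ b₀<n))
        (proj₁ (proj₁ occ′ (q a₀) (≤-trans i′≤i (proj₁ pos-a₀)) (≤-trans (proj₂ pos-a₀) j≤j′))))
        where pos-a₀ = proj₂ occ a₀ ≤-refl a₀≤b₀
      misses-first : ¬ u ≤ p i
      misses-first u≤pi with position-within occ′ i≤j u≤pi (proj₂ first-value) | m≤n⇒m<n∨m≡n (proj₂ within)
      ... | i′≤i , _ | inj₂ j′≡j = not-everything i′≤i (≤-reflexive (sym j′≡j))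
      ... | i′≤i , _ | inj₁ j′<j = no-high-prefix h1′ j′<j (subst (λ x → Occ P x j′ u b₀) (≤-antisym i′≤i (proj₁ within)) occ′)
        where h1′ = subst (_≤ j′) (≤-antisym i′≤i (proj₁ within)) h1
      misses-last : ¬ u ≤ p j
      misses-last u≤pj with position-within occ′ ≤-refl u≤pj (proj₂ last-value) | m≤n⇒m<n∨m≡n (proj₁ within)
      ... | _ , j≤j′ | inj₂ i≡i′ = not-everything (≤-reflexive (sym i≡i′)) j≤j′
      ... | _ , j≤j′ | inj₁ i<i′ = no-high-suffix i<i′ (≤-trans h1 (proj₂ within))
                                     (subst (λ x → Occ P i′ x u b₀) (≤-antisym (proj₂ within) j≤j′) occ′)

⊓≤⇒≤ : ∀ {m n k} → m ⊓ n ≤ k → k < m → n ≤ k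
⊓≤⇒≤ {m} {n} h k<m with m ≤? n
... | yes m≤n = ⊥-elim (<⇒≱ k<m (subst (_≤ _) (m≤n⇒m⊓n≡m m≤n) h))
... | no m≰n = subst (_≤ _) (m≥n⇒m⊓n≡n (<⇒≤ (≰⇒> m≰n))) h

≤⊔⇒≤ : ∀ {m n k} → k ≤ m ⊔ n → m < k → k ≤ n
≤⊔⇒≤ {m} {n} h m<k with m ≤? n
... | yes m≤n = subst (_ ≤_) (m≤n⇒m⊔n≡n m≤n) h
... | no m≰n = ⊥-elim (<⇒≱ m<k (subst (_ ≤_) (m≥n⇒m⊔n≡m (<⇒≤ (≰⇒> m≰n))) h))

module _ {n} (P : Perm n) where
  open Perm P

  overlapping-union : ∀ {a e c f i₁ j₁ i₂ j₂} → Occ P i₁ j₁ a e → Occ P i₂ j₂ c f → a < c → c ≤ e → e < f →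
    Occ P (i₁ ⊓ i₂) (j₁ ⊔ j₂) a f
  overlapping-union {a} {e} {c} {f} {i₁} {j₁} {i₂} {j₂} occ₁ occ₂ a<c c≤e e<f = vals , poss
    where
      pos₁-c = proj₂ occ₁ c (<⇒≤ a<c) c≤e
      pos₂-c = proj₂ occ₂ c ≤-refl (≤-trans c≤e (<⇒≤ e<f))
      -- both position ranges contain the position of c, so they cover the union
      cover : ∀ k → i₁ ⊓ i₂ ≤ k → k ≤ j₁ ⊔ j₂ → (i₁ ≤ k × k ≤ j₁) ⊎ (i₂ ≤ k × k ≤ j₂)
      cover k h1 h2 with k ≤? q c | i₁ ≤? k | k ≤? j₁
      ... | yes k≤qc | yes i₁≤k | _ = inj₁ (i₁≤k , ≤-trans k≤qc (proj₂ pos₁-c))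
      ... | yes k≤qc | no i₁≰k | _ = inj₂ (⊓≤⇒≤ h1 (≰⇒> i₁≰k) , ≤-trans k≤qc (proj₂ pos₂-c))
      ... | no k≰qc | _ | yes k≤j₁ = inj₁ (≤-trans (proj₁ pos₁-c) (<⇒≤ (≰⇒> k≰qc)) , k≤j₁)
      ... | no k≰qc | _ | no k≰j₁ = inj₂ (≤-trans (proj₁ pos₂-c) (<⇒≤ (≰⇒> k≰qc)) , ≤⊔⇒≤ h2 (≰⇒> k≰j₁))
      vals : MapsInto p (i₁ ⊓ i₂) (j₁ ⊔ j₂) a f
      vals k h1 h2 with cover k h1 h2
      ... | inj₁ (i₁≤k , k≤j₁) = let (a≤pk , pk≤e) = proj₁ occ₁ k i₁≤k k≤j₁ in a≤pk , ≤-trans pk≤e (<⇒≤ e<f)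
      ... | inj₂ (i₂≤k , k≤j₂) = let (c≤pk , pk≤f) = proj₁ occ₂ k i₂≤k k≤j₂ in ≤-trans (<⇒≤ a<c) c≤pk , pk≤f
      poss : MapsInto q a f (i₁ ⊓ i₂) (j₁ ⊔ j₂)
      poss v a≤v v≤f with v ≤? e
      ... | yes v≤e = let (h1 , h2) = proj₂ occ₁ v a≤v v≤e in ≤-trans (m⊓n≤m i₁ i₂) h1 , ≤-trans h2 (m≤m⊔n j₁ j₂)
      ... | no v≰e = let (h1 , h2) = proj₂ occ₂ v (≤-trans c≤e (<⇒≤ (≰⇒> v≰e))) v≤f in
                     ≤-trans (m⊓n≤n i₁ i₂) h1 , ≤-trans h2 (m≤n⊔m j₁ j₂)

module BlockWise {n} (P : Perm n) (B : BWSimple P) where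
  open Perm P

  no-split-in-two : ∀ {a₀ c b₀} → Interval P a₀ c → Interval P (suc c) b₀ → Interval P a₀ b₀ → ⊥
  no-split-in-two {c = c} (a₀≤c , _ , _ , _ , A₁≤A₂ , A₂<n , occA) (c<b₀ , _ , _ , _ , B₁≤B₂ , B₂<n , occB)
                  (_ , b₀<n , i , j , i≤j , j<n , occ) = first-in-neither (p i ≤? c)
    where
      open Parts P B i≤j j<n b₀<n occ
      first-in-neither : Dec (p i ≤ c) → ⊥
      first-in-neither (yes pi≤c) = proj₁ (low-part-misses-ends A₁≤A₂ A₂<n occA c<b₀) pi≤c
      first-in-neither (no pi≰c) = proj₁ (high-part-misses-ends B₁≤B₂ B₂<n occB (s≤s a₀≤c)) (≰⇒> pi≰c)

  -- The first and last entries avoid the lowest and the highest part, so both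
  -- lie in the middle part, which then is everything.
  no-split-in-three : ∀ {a₀ c₁ c₂ b₀} → Interval P a₀ c₁ → Interval P (suc c₁) c₂ → Interval P (suc c₂) b₀ →
    Interval P a₀ b₀ → ⊥
  no-split-in-three {a₀} {c₁} {c₂} (a₀≤c₁ , _ , _ , _ , A₁≤A₂ , A₂<n , occA) (c₁<c₂ , _ , _ , _ , _ , _ , occB)
                    (c₂<b₀ , _ , _ , _ , C₁≤C₂ , C₂<n , occC) (_ , b₀<n , i , j , i≤j , j<n , occ) =
    ends-in-middle (p i ≤? c₁) (c₂ <? p i) (p j ≤? c₁) (c₂ <? p j)
    where
      open Parts P B i≤j j<n b₀<n occ
      low = low-part-misses-ends A₁≤A₂ A₂<n occA (≤-trans (s≤s (≤-trans (n≤1+n c₁) c₁<c₂)) c₂<b₀)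
      high = high-part-misses-ends C₁≤C₂ C₂<n occC (s≤s (≤-trans a₀≤c₁ (≤-trans (n≤1+n c₁) c₁<c₂)))
      pos-a₀ = proj₂ occ a₀ ≤-refl a₀≤b₀
      ends-in-middle : Dec (p i ≤ c₁) → Dec (c₂ < p i) → Dec (p j ≤ c₁) → Dec (c₂ < p j) → ⊥
      ends-in-middle (yes pi≤c₁) _ _ _ = proj₁ low pi≤c₁
      ends-in-middle _ (yes c₂<pi) _ _ = proj₁ high c₂<pi
      ends-in-middle _ _ (yes pj≤c₁) _ = proj₂ low pj≤c₁
      ends-in-middle _ _ _ (yes c₂<pj) = proj₂ high c₂<pj
      ends-in-middle (no pi≰c₁) (no c₂≮pi) (no pj≰c₁) (no c₂≮pj) =
        <⇒≱ (s≤s a₀≤c₁) (subst (suc c₁ ≤_) (p∘q (≤-<-trans a₀≤b₀ b₀<n))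
          (proj₁ (proj₁ occB (q a₀) (≤-trans B₁≤i (proj₁ pos-a₀)) (≤-trans (proj₂ pos-a₀) j≤B₂))))
        where
          B₁≤i = proj₁ (position-within occB i≤j (≰⇒> pi≰c₁) (≮⇒≥ c₂≮pi))
          j≤B₂ = proj₂ (position-within occB ≤-refl (≰⇒> pj≰c₁) (≮⇒≥ c₂≮pj))

  -- Overlapping intervals would split their union into a low and a high part.
  no-overlap : ∀ {a e c f} → Interval P a e → Interval P c f → a < c → c ≤ e → e < f → ⊥
  no-overlap {a} {e} {c} {f} (_ , _ , i₁ , j₁ , i₁≤j₁ , j₁<n , occ₁) (_ , f<n , i₂ , j₂ , i₂≤j₂ , j₂<n , occ₂) a<c c≤e e<f =
    first-in-neither (p (i₁ ⊓ i₂) ≤? e)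
    where
      open Parts P B (≤-trans (m⊓n≤m i₁ i₂) (≤-trans i₁≤j₁ (m≤m⊔n j₁ j₂))) (⊔-lub j₁<n j₂<n) f<n
                     (overlapping-union P occ₁ occ₂ a<c c≤e e<f)
      first-in-neither : Dec (p (i₁ ⊓ i₂) ≤ e) → ⊥
      first-in-neither (yes p≤e) = proj₁ (low-part-misses-ends i₁≤j₁ j₁<n occ₁ e<f) p≤e
      first-in-neither (no p≰e) = proj₁ (high-part-misses-ends i₂≤j₂ j₂<n occ₂ a<c) (≤-trans c≤e (<⇒≤ (≰⇒> p≰e)))

module _ {n} (P : Perm n) where
  open Perm P

  MapsInto? : ∀ f i j a b → Dec (MapsInto f i j a b)
  MapsInto? f i j a b with allUpTo? (λ k → (i ≤? k) →-dec ((a ≤? f k) ×-dec (f k ≤? b))) (suc j)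
  ... | yes all = yes λ k i≤k k≤j → all (s≤s k≤j) i≤k
  ... | no ¬all = no λ maps → ¬all λ {k} k<1+j i≤k → maps k i≤k (≤-pred k<1+j)

  Occ? : ∀ i j a b → Dec (Occ P i j a b)
  Occ? i j a b = MapsInto? p i j a b ×-dec MapsInto? q a b i j

  Interval? : ∀ a b → Dec (Interval P a b)
  Interval? a b with a ≤? b | b <? n | anyUpTo? (λ i → anyUpTo? (λ j → (i ≤? j) ×-dec Occ? i j a b) n) n
  ... | yes a≤b | yes b<n | yes (i , _ , j , j<n , i≤j , occ) = yes (a≤b , b<n , i , j , i≤j , j<n , occ)
  ... | no a≰b | _ | _ = no λ I → a≰b (proj₁ I)
  ... | _ | no b≮n | _ = no λ I → b≮n (proj₁ (proj₂ I))
  ... | _ | _ | no none = no λ { (_ , _ , i , j , i≤j , j<n , occ) → none (i , ≤-<-trans i≤j j<n , j , j<n , i≤j , occ) }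

1+pred : ∀ {x y} → x < y → suc (pred y) ≡ y
1+pred (s≤s _) = refl

pred-< : ∀ {x y z} → x < y → y < z → pred y < pred z
pred-< {y = suc _} {suc _} _ (s≤s h) = h

-- The segment {x, y} of the dissection read off from P corresponds to the interval [x, y-1].
module Diagonals {n} (P : Perm n) where
  Diagonal : ℕ → ℕ → Set
  Diagonal x y = x < y × y ≤ n × ¬ Side n x y × Interval P x (pred y)

  Side? : ∀ x y → Dec (Side n x y)
  Side? x y = (suc x ≟ y) ⊎-dec ((x ≟ 0) ×-dec (y ≟ n))

  Diagonal? : ∀ x y → Dec (Diagonal x y)
  Diagonal? x y = (x <? y) ×-dec ((y ≤? n) ×-dec (¬? (Side? x y) ×-dec Interval? P x (pred y)))

  segment-Interval : ∀ {x y} → x < y → y ≤ n → Segment n Diagonal x y → Interval P x (pred y)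
  segment-Interval {x} _ y≤n (inj₁ (inj₁ refl)) = singleton-Interval P y≤n
  segment-Interval x<y _ (inj₁ (inj₂ (refl , refl))) = whole-Interval P (1+pred x<y)
  segment-Interval _ _ (inj₂ c) = proj₂ (proj₂ (proj₂ c))

  realizes : Realizes P Diagonal
  realizes c d = mk⇔ to (λ (c≤d , d<n , seg) → segment-Interval (s≤s c≤d) d<n seg)
    where
      to : Interval P c d → SegmentOver n Diagonal c d
      to I@(c≤d , d<n , _) with c ≟ d | (c ≟ 0) ×-dec (suc d ≟ n)
      ... | yes c≡d | _ = c≤d , d<n , inj₁ (inj₁ (cong suc c≡d))
      ... | no _ | yes whole = c≤d , d<n , inj₁ (inj₂ whole)
      ... | no c≢d | no not-whole = c≤d , d<n , inj₂ (s≤s c≤d , d<n , not-side , I)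
        where
          not-side : ¬ Side n c (suc d)
          not-side (inj₁ e) = c≢d (suc-injective e)
          not-side (inj₂ e) = not-whole e

  dissection : BWSimple P → Dissection n Diagonal
  dissection B = record
    { chosen? = Diagonal?
    ; diagonal = λ (x<y , y≤n , not-side , _) → x<y , y≤n , not-side
    ; non-crossing = λ c₁ c₂ h1 h2 h3 →
        no-overlap (proj₂ (proj₂ (proj₂ c₁))) (proj₂ (proj₂ (proj₂ c₂))) h1 (<⇒≤pred h2) (pred-< h2 h3)
    ; no-triangle = λ {x} {y} {z} h1 h2 h3 s1 s2 s3 →
        no-split-in-two (segment-Interval h1 (≤-trans (<⇒≤ h2) h3) s1)
             (subst (λ u → Interval P u (pred z)) (sym (1+pred h1)) (segment-Interval h2 h3 s2))
             (segment-Interval (<-trans h1 h2) h3 s3)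
    ; no-quadrilateral = λ {x} {y} {z} {w} h1 h2 h3 h4 s1 s2 s3 s4 _ _ →
        no-split-in-three (segment-Interval h1 (≤-trans (<⇒≤ h2) (≤-trans (<⇒≤ h3) h4)) s1)
              (subst (λ u → Interval P u (pred z)) (sym (1+pred h1)) (segment-Interval h2 (≤-trans (<⇒≤ h3) h4) s2))
              (subst (λ u → Interval P u (pred w)) (sym (1+pred (<-trans h1 h2))) (segment-Interval h3 h4 s3))
              (segment-Interval (<-trans h1 (<-trans h2 h3)) h4 s4)
    }
    where open BlockWise P B

≤-suc-cases : ∀ {k h} → k ≤ suc h → k ≤ h ⊎ k ≡ suc h
≤-suc-cases k≤1+h with m≤n⇒m<n∨m≡n k≤1+h
... | inj₁ k<1+h = inj₁ (≤-pred k<1+h)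
... | inj₂ k≡1+h = inj₂ k≡1+h

argmax : ∀ (f : ℕ → ℕ) l h → l ≤ h → ∃[ k₀ ] (l ≤ k₀ × k₀ ≤ h × (∀ k → l ≤ k → k ≤ h → f k ≤ f k₀))
argmax f l zero z≤n = 0 , z≤n , z≤n , λ { k _ z≤n → ≤-refl }
argmax f l (suc h) l≤1+h with l ≤? h
... | no l≰h = suc h , l≤1+h , ≤-refl , λ k l≤k k≤1+h → ≤-reflexive (cong f (≤-antisym k≤1+h (≤-trans (≰⇒> l≰h) l≤k)))
... | yes l≤h with argmax f l h l≤h
...   | k₀ , l≤k₀ , k₀≤h , max with f k₀ ≤? f (suc h)
...     | yes fk₀≤ = suc h , l≤1+h , ≤-refl , λ k l≤k k≤1+h →
            [ (λ k≤h → ≤-trans (max k l≤k k≤h) fk₀≤) , (λ k≡1+h → ≤-reflexive (cong f k≡1+h)) ]′ (≤-suc-cases k≤1+h)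
...     | no fk₀≰ = k₀ , l≤k₀ , m≤n⇒m≤1+n k₀≤h , λ k l≤k k≤1+h →
            [ max k l≤k , (λ k≡1+h → subst (λ x → f x ≤ f k₀) (sym k≡1+h) (<⇒≤ (≰⇒> fk₀≰))) ]′ (≤-suc-cases k≤1+h)

-- The values split at the largest value c on the first range of positions.
module _ {n} (P : Perm n) where
  open Perm P

  split-values : ∀ {i j a₀ b₀ l₁ h₁ l₂ h₂} → j < n → b₀ < n → Occ P i j a₀ b₀ → l₁ ≤ h₁ → l₂ ≤ h₂ →
    i ≤ l₁ → h₁ ≤ j → i ≤ l₂ → h₂ ≤ j →
    (∀ k → i ≤ k → k ≤ j → (l₁ ≤ k × k ≤ h₁) ⊎ (l₂ ≤ k × k ≤ h₂)) →
    (∀ k l → l₁ ≤ k → k ≤ h₁ → l₂ ≤ l → l ≤ h₂ → p k < p l) →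
    ∃[ c ] (Interval P a₀ c × Interval P (suc c) b₀)
  split-values {i} {j} {a₀} {b₀} {l₁} {h₁} {l₂} {h₂} j<n b₀<n occ l₁≤h₁ l₂≤h₂ i≤l₁ h₁≤j i≤l₂ h₂≤j cover below =
      c , (a₀≤c , c<n , l₁ , h₁ , l₁≤h₁ , ≤-<-trans h₁≤j j<n , occ₁) ,
          (c<b₀ , b₀<n , l₂ , h₂ , l₂≤h₂ , ≤-<-trans h₂≤j j<n , occ₂)
    where
      M = argmax p l₁ h₁ l₁≤h₁
      k₀ = proj₁ M
      l₁≤k₀ = proj₁ (proj₂ M)
      k₀≤h₁ = proj₁ (proj₂ (proj₂ M))
      max = proj₂ (proj₂ (proj₂ M))
      c = p k₀
      a₀≤c : a₀ ≤ c
      a₀≤c = proj₁ (proj₁ occ k₀ (≤-trans i≤l₁ l₁≤k₀) (≤-trans k₀≤h₁ h₁≤j))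
      c<b₀ : c < b₀
      c<b₀ = ≤-trans (below k₀ l₂ l₁≤k₀ k₀≤h₁ ≤-refl l₂≤h₂) (proj₂ (proj₁ occ l₂ i≤l₂ (≤-trans l₂≤h₂ h₂≤j)))
      c<n : c < n
      c<n = ≤-<-trans (<⇒≤ c<b₀) b₀<n
      occ₁ : Occ P l₁ h₁ a₀ c
      occ₁ = (λ k h h′ → proj₁ (proj₁ occ k (≤-trans i≤l₁ h) (≤-trans h′ h₁≤j)) , max k h h′) , poss
        where
          poss : MapsInto q a₀ c l₁ h₁
          poss v a₀≤v v≤c with proj₂ occ v a₀≤v (≤-trans v≤c (<⇒≤ c<b₀))
          ... | i≤qv , qv≤j with cover (q v) i≤qv qv≤j
          ...   | inj₁ in₁ = in₁
          ...   | inj₂ (l₂≤qv , qv≤h₂) = ⊥-elim (<⇒≱ (below k₀ (q v) l₁≤k₀ k₀≤h₁ l₂≤qv qv≤h₂)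
                                            (subst (_≤ c) (sym (p∘q (≤-<-trans (≤-trans v≤c (<⇒≤ c<b₀)) b₀<n))) v≤c))
      occ₂ : Occ P l₂ h₂ (suc c) b₀
      occ₂ = (λ k h h′ → below k₀ k l₁≤k₀ k₀≤h₁ h h′ , proj₂ (proj₁ occ k (≤-trans i≤l₂ h) (≤-trans h′ h₂≤j))) , poss
        where
          poss : MapsInto q (suc c) b₀ l₂ h₂
          poss v c<v v≤b₀ with proj₂ occ v (≤-trans a₀≤c (≤-trans (n≤1+n c) c<v)) v≤b₀
          ... | i≤qv , qv≤j with cover (q v) i≤qv qv≤j
          ...   | inj₂ in₂ = in₂
          ...   | inj₁ (l₁≤qv , qv≤h₁) = ⊥-elim (<⇒≱ c<v (subst (_≤ c) (p∘q (≤-<-trans v≤b₀ b₀<n)) (max (q v) l₁≤qv qv≤h₁)))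

-- A direct or skew sum block would split its interval into two intervals,
-- i.e. give a triangle of segments.
realizer-BWSimple : ∀ {n C} → Dissection n C → (P : Perm n) → Realizes P C → BWSimple P
realizer-BWSimple {n} {C} D P R i j (i≤j , j<n , a₀ , b₀ , b₀<n , occ) sum =
  Dissection.no-triangle D (s≤s (proj₁ lower)) (s≤s (proj₁ upper)) b₀<n (segment-of lower) (segment-of upper) (segment-of whole)
  where
    segment-of : ∀ {c d} → Interval P c d → Segment n C c (suc d)
    segment-of I = proj₂ (proj₂ (Equivalence.to (R _ _) I))
    whole : Interval P a₀ b₀
    whole = ≤-trans (proj₁ (proj₁ occ i ≤-refl i≤j)) (proj₂ (proj₁ occ i ≤-refl i≤j)) , b₀<n , i , j , i≤j , j<n , occ
    split : Direct P i j ⊎ Skew P i j → ∃[ c ] (Interval P a₀ c × Interval P (suc c) b₀)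
    split (inj₁ (m , i≤m , m<j , ordered)) =
      split-values P j<n b₀<n occ i≤m m<j ≤-refl (<⇒≤ m<j) (≤-trans i≤m (n≤1+n m)) ≤-refl cover ordered
      where
        cover : ∀ k → i ≤ k → k ≤ j → (i ≤ k × k ≤ m) ⊎ (suc m ≤ k × k ≤ j)
        cover k i≤k k≤j with k ≤? m
        ... | yes k≤m = inj₁ (i≤k , k≤m)
        ... | no k≰m = inj₂ (≰⇒> k≰m , k≤j)
    split (inj₂ (m , i≤m , m<j , ordered)) =
      split-values P j<n b₀<n occ m<j i≤m (≤-trans i≤m (n≤1+n m)) ≤-refl ≤-refl (<⇒≤ m<j) cover
        (λ k l h1 h2 h3 h4 → ordered l k h3 h4 h1 h2)
      where
        cover : ∀ k → i ≤ k → k ≤ j → (suc m ≤ k × k ≤ j) ⊎ (i ≤ k × k ≤ m)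
        cover k i≤k k≤j with k ≤? m
        ... | yes k≤m = inj₂ (i≤k , k≤m)
        ... | no k≰m = inj₁ (≰⇒> k≰m , k≤j)
    lower = proj₁ (proj₂ (split sum))
    upper = proj₂ (proj₂ (split sum))

record Represents {n} (π : Permutation′ n) (P : Perm n) : Set where
  field
    p-toℕ : ∀ k → Perm.p P (toℕ k) ≡ toℕ (π ⟨$⟩ʳ k)
    q-toℕ : ∀ v → Perm.q P (toℕ v) ≡ toℕ (π ⟨$⟩ˡ v)

fin-of : ∀ {n x} → x < n → ∃[ X ] toℕ {n} X ≡ x
fin-of x<n = fromℕ< x<n , toℕ-fromℕ< x<n

module _ {n : ℕ} where
  extend : (Fin n → Fin n) → ℕ → ℕ
  extend f k with k <? n
  ... | yes k<n = toℕ (f (fromℕ< k<n))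
  ... | no _ = 0

  extend-< : ∀ f {k} (k<n : k < n) → extend f k ≡ toℕ (f (fromℕ< k<n))
  extend-< f {k} k<n with k <? n
  ... | yes _ = refl
  ... | no k≮n = ⊥-elim (k≮n k<n)

  extend-toℕ : ∀ f (x : Fin n) → extend f (toℕ x) ≡ toℕ (f x)
  extend-toℕ f x = trans (extend-< f (toℕ<n x)) (cong (λ y → toℕ (f y)) (fromℕ<-toℕ x (toℕ<n x)))

  toPerm : Permutation′ n → Perm n
  toPerm π = record
    { p = extend (π ⟨$⟩ʳ_)
    ; q = extend (π ⟨$⟩ˡ_)
    ; p< = λ k<n → subst (_< n) (sym (extend-< _ k<n)) (toℕ<n _)
    ; q< = λ v<n → subst (_< n) (sym (extend-< _ v<n)) (toℕ<n _)
    ; p∘q = λ v<n → trans (cong (extend (π ⟨$⟩ʳ_)) (extend-< _ v<n))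
                      (trans (extend-toℕ _ _) (trans (cong toℕ (inverseʳ π)) (toℕ-fromℕ< v<n)))
    ; q∘p = λ k<n → trans (cong (extend (π ⟨$⟩ˡ_)) (extend-< _ k<n))
                      (trans (extend-toℕ _ _) (trans (cong toℕ (inverseˡ π)) (toℕ-fromℕ< k<n)))
    }

  toPerm-represents : ∀ π → Represents π (toPerm π)
  toPerm-represents π = record { p-toℕ = extend-toℕ _ ; q-toℕ = extend-toℕ _ }

  fromPerm : Perm n → Permutation′ n
  fromPerm P = permutation (λ x → fromℕ< (p< (toℕ<n x))) (λ x → fromℕ< (q< (toℕ<n x)))
    (λ y → toℕ-injective (trans (toℕ-fromℕ< _) (trans (cong p (toℕ-fromℕ< _)) (p∘q (toℕ<n y)))))
    (λ y → toℕ-injective (trans (toℕ-fromℕ< _) (trans (cong q (toℕ-fromℕ< _)) (q∘p (toℕ<n y)))))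
    where open Perm P

  represents-fromPerm : ∀ P → Represents (fromPerm P) P
  represents-fromPerm P = record { p-toℕ = λ k → sym (toℕ-fromℕ< _) ; q-toℕ = λ v → sym (toℕ-fromℕ< _) }

module Representation {n} {π : Permutation′ n} {P : Perm n} (R : Represents π P) where
  open Perm P
  open Represents R

  Occupies⇒Occ : ∀ {i j a b} → Occupies π i j a b → Occ P (toℕ i) (toℕ j) (toℕ a) (toℕ b)
  Occupies⇒Occ {i} {j} {a} {b} (vals , poss) = vals′ , poss′
    where
      vals′ : MapsInto p (toℕ i) (toℕ j) (toℕ a) (toℕ b)
      vals′ k i≤k k≤j with fin-of (≤-<-trans k≤j (toℕ<n j))
      ... | K , refl = subst (λ u → toℕ a ≤ u × u ≤ toℕ b) (sym (p-toℕ K)) (vals K i≤k k≤j)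
      poss′ : MapsInto q (toℕ a) (toℕ b) (toℕ i) (toℕ j)
      poss′ v a≤v v≤b with fin-of (≤-<-trans v≤b (toℕ<n b))
      ... | V , refl with poss V a≤v v≤b
      ...   | K , i≤K , K≤j , πK≡V = subst (λ u → toℕ i ≤ u × u ≤ toℕ j) q-V≡K (i≤K , K≤j)
        where
          q-V≡K : toℕ K ≡ q (toℕ V)
          q-V≡K = sym (trans (q-toℕ V) (cong toℕ (trans (cong (π ⟨$⟩ˡ_) (sym πK≡V)) (inverseˡ π))))

  Occ⇒Occupies : ∀ {i j a b} → Occ P (toℕ i) (toℕ j) (toℕ a) (toℕ b) → Occupies π i j a b
  Occ⇒Occupies {i} {j} {a} {b} (vals , poss) =
    (λ K i≤K K≤j → subst (λ u → toℕ a ≤ u × u ≤ toℕ b) (p-toℕ K) (vals (toℕ K) i≤K K≤j)) ,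
    (λ V a≤V V≤b → let (i≤K , K≤j) = subst (λ u → toℕ i ≤ u × u ≤ toℕ j) (q-toℕ V) (poss (toℕ V) a≤V V≤b) in
                   (π ⟨$⟩ˡ V) , i≤K , K≤j , inverseʳ π)

  IsInterval⇔Interval : ∀ {a b} → IsInterval π a b ⇔ Interval P (toℕ a) (toℕ b)
  IsInterval⇔Interval {a} {b} = mk⇔ to from
    where
      to : IsInterval π a b → Interval P (toℕ a) (toℕ b)
      to (a≤b , i , j , i≤j , occ) = a≤b , toℕ<n b , toℕ i , toℕ j , i≤j , toℕ<n j , Occupies⇒Occ occ
      from : Interval P (toℕ a) (toℕ b) → IsInterval π a b
      from (a≤b , _ , i , j , i≤j , j<n , occ) with fin-of (≤-<-trans i≤j j<n) | fin-of j<n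
      ... | I , refl | J , refl = a≤b , I , J , i≤j , Occ⇒Occupies occ

  FinSumAt : (ℕ → ℕ → Set) → Fin n → Fin n → Set
  FinSumAt R I J = Σ[ M ∈ Fin n ] (toℕ I ≤ toℕ M × toℕ M < toℕ J ×
    (∀ K L → toℕ I ≤ toℕ K → toℕ K ≤ toℕ M → toℕ M < toℕ L → toℕ L ≤ toℕ J → R (toℕ (val π K)) (toℕ (val π L))))

  FinSumAt⇒SumAt : ∀ {R I J} → FinSumAt R I J → SumAt R P (toℕ I) (toℕ J)
  FinSumAt⇒SumAt {R} {I} {J} (M , I≤M , M<J , related) = toℕ M , I≤M , M<J , related′
    where
      related′ : ∀ k l → toℕ I ≤ k → k ≤ toℕ M → toℕ M < l → l ≤ toℕ J → R (p k) (p l)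
      related′ k l h1 h2 h3 h4 with fin-of (≤-<-trans h2 (<-trans M<J (toℕ<n J))) | fin-of (≤-<-trans h4 (toℕ<n J))
      ... | K , refl | L , refl = subst₂ R (sym (p-toℕ K)) (sym (p-toℕ L)) (related K L h1 h2 h3 h4)

  SumAt⇒FinSumAt : ∀ {R I J} → SumAt R P (toℕ I) (toℕ J) → FinSumAt R I J
  SumAt⇒FinSumAt {R} {I} {J} (m , i≤m , m<j , related) with fin-of (<-trans m<j (toℕ<n J))
  ... | M , refl = M , i≤m , m<j ,
        λ K L h1 h2 h3 h4 → subst₂ R (p-toℕ K) (p-toℕ L) (related (toℕ K) (toℕ L) h1 h2 h3 h4)

  BWSimple⇒BlockWiseSimple : BWSimple P → BlockWiseSimple π
  BWSimple⇒BlockWiseSimple B I J (I≤J , A , B′ , occ) sum =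
    B (toℕ I) (toℕ J) (I≤J , toℕ<n J , toℕ A , toℕ B′ , toℕ<n B′ , Occupies⇒Occ occ)
      (⊎-map (FinSumAt⇒SumAt {_<_}) (FinSumAt⇒SumAt {_>_}) sum)

  BlockWiseSimple⇒BWSimple : BlockWiseSimple π → BWSimple P
  BlockWiseSimple⇒BWSimple B i j (i≤j , j<n , a , b , b<n , occ) sum
    with fin-of (≤-<-trans i≤j j<n) | fin-of j<n | fin-of (≤-<-trans (≤-trans (proj₁ (proj₁ occ i ≤-refl i≤j)) (proj₂ (proj₁ occ i ≤-refl i≤j))) b<n) | fin-of b<n
  ... | I , refl | J , refl | A , refl | B′ , refl =
    B I J (i≤j , A , B′ , Occ⇒Occupies occ) (⊎-map (SumAt⇒FinSumAt {_<_}) (SumAt⇒FinSumAt {_>_}) sum)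

represents-same-Interval : ∀ {n} {π : Permutation′ n} {P P′ : Perm n} → Represents π P → Represents π P′ →
  ∀ {c d} → Interval P c d → Interval P′ c d
represents-same-Interval R R′ I@(c≤d , d<n , _) with fin-of (≤-<-trans c≤d d<n) | fin-of d<n
... | _ , refl | _ , refl = Equivalence.to (IsInterval⇔Interval R′) (Equivalence.from (IsInterval⇔Interval R) I)
  where open Representation

Dissection-resp : ∀ {n} {C C′ : ℕ → ℕ → Set} → (∀ {x y} → C x y → C′ x y) → (∀ {x y} → C′ x y → C x y) →
  Dissection n C → Dissection n C′
Dissection-resp {n} {C} {C′} to from D = record
  { chosen? = λ x y → Dec-map (chosen? x y)
  ; diagonal = λ c → diagonal (from c)
  ; non-crossing = λ c₁ c₂ → non-crossing (from c₁) (from c₂)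
  ; no-triangle = λ h1 h2 h3 s1 s2 s3 → no-triangle h1 h2 h3 (segment s1) (segment s2) (segment s3)
  ; no-quadrilateral = λ h1 h2 h3 h4 s1 s2 s3 s4 n1 n2 →
      no-quadrilateral h1 h2 h3 h4 (segment s1) (segment s2) (segment s3) (segment s4) (λ c → n1 (to c)) (λ c → n2 (to c))
  }
  where
    open Dissection D
    Dec-map : ∀ {x y} → Dec (C x y) → Dec (C′ x y)
    Dec-map (yes c) = yes (to c)
    Dec-map (no ¬c) = no (λ c′ → ¬c (from c′))
    segment : ∀ {x y} → Segment n C′ x y → Segment n C x y
    segment = ⊎-map (λ side → side) from

realized-diagonals : ∀ {n C} → Dissection n C → (P : Perm n) → Realizes P C →
  ∀ {x y} → C x y ⇔ Diagonals.Diagonal P x y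
realized-diagonals {n} {C} D P R {x} {y} = mk⇔ to from
  where
    open Dissection D
    to : C x y → Diagonals.Diagonal P x y
    to c with diagonal c
    ... | x<y , y≤n , not-side = x<y , y≤n , not-side ,
          Equivalence.from (R x (pred y)) (<⇒≤pred x<y , pred-< x<y (s≤s y≤n) ,
                                           inj₂ (subst (C x) (sym (1+pred x<y)) c))
    from : Diagonals.Diagonal P x y → C x y
    from (x<y , _ , not-side , I) with proj₂ (proj₂ (Equivalence.to (R x (pred y)) I))
    ... | inj₁ side = ⊥-elim (not-side (subst (Side n x) (1+pred x<y) side))
    ... | inj₂ c = subst (C x) (1+pred x<y) c

module _ {n : ℕ} where
  Chosenℕ : DiagSet (suc n) → ℕ → ℕ → Set
  Chosenℕ D x y = Σ (x < suc n) λ x< → Σ (y < suc n) λ y< → Chosen D (fromℕ< x<) (fromℕ< y<)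

  Chosenℕ? : ∀ D x y → Dec (Chosenℕ D x y)
  Chosenℕ? D x y with x <? suc n | y <? suc n
  ... | no x≮ | _ = no λ c → x≮ (proj₁ c)
  ... | yes _ | no y≮ = no λ c → y≮ (proj₁ (proj₂ c))
  ... | yes x< | yes y< with T? (D (fromℕ< x<) (fromℕ< y<))
  ...   | yes c = yes (x< , y< , c)
  ...   | no ¬c = no λ c → ¬c (proj₂ (proj₂ c))

  Chosen⇒Chosenℕ : ∀ {D} i j → Chosen D i j → Chosenℕ D (toℕ i) (toℕ j)
  Chosen⇒Chosenℕ {D} i j c = toℕ<n i , toℕ<n j , subst₂ (Chosen D) (sym (fromℕ<-toℕ i _)) (sym (fromℕ<-toℕ j _)) c

  Chosenℕ⇒Chosen : ∀ {D} i j → Chosenℕ D (toℕ i) (toℕ j) → Chosen D i j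
  Chosenℕ⇒Chosen {D} i j (_ , _ , c) = subst₂ (Chosen D) (fromℕ<-toℕ i _) (fromℕ<-toℕ j _) c

  IsSide⇒Side : ∀ {i j} → IsSide (suc n) i j → Side n (toℕ i) (toℕ j)
  IsSide⇒Side = ⊎-map (λ e → e) (λ (i≡0 , e) → i≡0 , suc-injective e)

  Side⇒IsSide : ∀ {i j} → Side n (toℕ i) (toℕ j) → IsSide (suc n) i j
  Side⇒IsSide = ⊎-map (λ e → e) (λ (i≡0 , e) → i≡0 , cong suc e)

  Seg⇒Segment : ∀ {D} i j → Seg (suc n) D i j → Segment n (Chosenℕ D) (toℕ i) (toℕ j)
  Seg⇒Segment {D} i j = ⊎-map IsSide⇒Side (Chosen⇒Chosenℕ {D} i j)

  Segment⇒Seg : ∀ {D} i j → Segment n (Chosenℕ D) (toℕ i) (toℕ j) → Seg (suc n) D i j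
  Segment⇒Seg {D} i j = ⊎-map Side⇒IsSide (Chosenℕ⇒Chosen {D} i j)

  Dissection⇒ValidPlacement : ∀ {D} → Dissection n (Chosenℕ D) → ValidPlacement (suc n) D
  Dissection⇒ValidPlacement {D} Diss = well-formed , non-crossing′ , no-triangle′ , no-quadrilateral′
    where
      open Dissection Diss
      well-formed : WellFormed (suc n) D
      well-formed i j c = let (i<j , _ , not-side) = diagonal (Chosen⇒Chosenℕ {D} i j c) in
                          i<j , λ side → not-side (IsSide⇒Side side)
      non-crossing′ : NonCrossing D
      non-crossing′ a b c d cab ccd (a<c , c<b , b<d) =
        non-crossing (Chosen⇒Chosenℕ {D} a b cab) (Chosen⇒Chosenℕ {D} c d ccd) a<c c<b b<d
      no-triangle′ : ¬ HasTriangle (suc n) D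
      no-triangle′ (i , j , k , i<j , j<k , s1 , s2 , s3) =
        no-triangle i<j j<k (≤-pred (toℕ<n k)) (Seg⇒Segment {D} i j s1) (Seg⇒Segment {D} j k s2) (Seg⇒Segment {D} i k s3)
      no-quadrilateral′ : ¬ HasQuadrilateral (suc n) D
      no-quadrilateral′ (i , j , k , l , i<j , j<k , k<l , s1 , s2 , s3 , s4 , n1 , n2) =
        no-quadrilateral i<j j<k k<l (≤-pred (toℕ<n l))
          (Seg⇒Segment {D} i j s1) (Seg⇒Segment {D} j k s2) (Seg⇒Segment {D} k l s3) (Seg⇒Segment {D} i l s4)
          (λ c → n1 (Chosenℕ⇒Chosen {D} i k c)) (λ c → n2 (Chosenℕ⇒Chosen {D} j l c))

  ValidPlacement⇒Dissection : ∀ {D} → ValidPlacement (suc n) D → Dissection n (Chosenℕ D)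
  ValidPlacement⇒Dissection {D} (well-formed , non-crossing , no-triangle , no-quadrilateral) = record
    { chosen? = Chosenℕ? D
    ; diagonal = diagonal
    ; non-crossing = non-crossing′
    ; no-triangle = no-triangle′
    ; no-quadrilateral = no-quadrilateral′
    }
    where
      diagonal : ∀ {x y} → Chosenℕ D x y → x < y × y ≤ n × ¬ Side n x y
      diagonal {x} {y} c@(x< , y< , _) with fin-of x< | fin-of y<
      ... | X , refl | Y , refl = let (X<Y , not-side) = well-formed X Y (Chosenℕ⇒Chosen {D} X Y c) in
                                  X<Y , ≤-pred (toℕ<n Y) , λ side → not-side (Side⇒IsSide side)
      non-crossing′ : ∀ {a b c d} → Chosenℕ D a b → Chosenℕ D c d → a < c → c < b → b < d → ⊥
      non-crossing′ cab@(a< , b< , _) ccd@(c< , d< , _) a<c c<b b<d with fin-of a< | fin-of b< | fin-of c< | fin-of d<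
      ... | A , refl | B , refl | C , refl | E , refl =
        non-crossing A B C E (Chosenℕ⇒Chosen {D} A B cab) (Chosenℕ⇒Chosen {D} C E ccd) (a<c , c<b , b<d)
      no-triangle′ : ∀ {x y z} → x < y → y < z → z ≤ n →
        Segment n (Chosenℕ D) x y → Segment n (Chosenℕ D) y z → Segment n (Chosenℕ D) x z → ⊥
      no-triangle′ x<y y<z z≤last s1 s2 s3 with fin-of (s≤s z≤last)
      ... | Z , refl with fin-of (<-trans y<z (toℕ<n Z))
      ...   | Y , refl with fin-of (<-trans x<y (toℕ<n Y))
      ...     | X , refl =
        no-triangle (X , Y , Z , x<y , y<z , Segment⇒Seg {D} X Y s1 , Segment⇒Seg {D} Y Z s2 , Segment⇒Seg {D} X Z s3)
      no-quadrilateral′ : ∀ {x y z w} → x < y → y < z → z < w → w ≤ n →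
        Segment n (Chosenℕ D) x y → Segment n (Chosenℕ D) y z → Segment n (Chosenℕ D) z w →
        Segment n (Chosenℕ D) x w → ¬ Chosenℕ D x z → ¬ Chosenℕ D y w → ⊥
      no-quadrilateral′ x<y y<z z<w w≤n s1 s2 s3 s4 n1 n2 with fin-of (s≤s w≤n)
      ... | W , refl with fin-of (<-trans z<w (toℕ<n W))
      ...   | Z , refl with fin-of (<-trans y<z (toℕ<n Z))
      ...     | Y , refl with fin-of (<-trans x<y (toℕ<n Y))
      ...       | X , refl =
        no-quadrilateral (X , Y , Z , W , x<y , y<z , z<w ,
          Segment⇒Seg {D} X Y s1 , Segment⇒Seg {D} Y Z s2 , Segment⇒Seg {D} Z W s3 , Segment⇒Seg {D} X W s4 ,
          (λ c → n1 (Chosen⇒Chosenℕ {D} X Z c)) , (λ c → n2 (Chosen⇒Chosenℕ {D} Y W c)))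

Enumeration : (A : Set) → (A → A → Set) → ℕ → Set
Enumeration A R k = Σ[ g ∈ (Fin k → A) ] ((∀ i j → R (g i) (g j) → i ≡ j) × (∀ a → ∃[ i ] R a (g i)))

-- k counts the elements of A satisfying P, up to R; NumPlacements and
-- NumDistinctPosets are instances.
Count : (A : Set) → (A → Set) → (A → A → Set) → ℕ → Set
Count A P R k = Σ[ g ∈ (Fin k → A) ] ((∀ i → P (g i)) × (∀ i j → R (g i) (g j) → i ≡ j) × (∀ a → P a → ∃[ i ] R a (g i)))

Pointwise : ∀ {X : Set} → (X → X → Set) → ∀ {m} → (Fin m → X) → (Fin m → X) → Set
Pointwise R f g = ∀ x → R (f x) (g x)

Bool-enumeration : Enumeration Bool _≡_ 2
Bool-enumeration = g , injective , surjective
  where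
    g : Fin 2 → Bool
    g fzero = false
    g (fsuc fzero) = true
    injective : ∀ i j → g i ≡ g j → i ≡ j
    injective fzero fzero _ = refl
    injective fzero (fsuc fzero) ()
    injective (fsuc fzero) fzero ()
    injective (fsuc fzero) (fsuc fzero) _ = refl
    surjective : ∀ b → ∃[ i ] b ≡ g i
    surjective false = fzero , refl
    surjective true = fsuc fzero , refl

cons : ∀ {X : Set} {m} → X → (Fin m → X) → Fin (suc m) → X
cons x f fzero = x
cons x f (fsuc j) = f j

function-enumeration : ∀ {X : Set} {R : X → X → Set} {k} → Enumeration X R k → ∀ m → Enumeration (Fin m → X) (Pointwise R) (k ^ m)
function-enumeration _ zero = (λ _ ()) , (λ { fzero fzero _ → refl }) , (λ f → fzero , λ ())
function-enumeration {X} {R} {k} E@(g₁ , injective₁ , surjective₁) (suc m) = g , injective , surjective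
  where
    E′ = function-enumeration {R = R} E m
    g₂ = proj₁ E′
    g : Fin (k * k ^ m) → Fin (suc m) → X
    g i = cons (g₁ (proj₁ (remQuot {k} (k ^ m) i))) (g₂ (proj₂ (remQuot {k} (k ^ m) i)))
    injective : ∀ i j → Pointwise R (g i) (g j) → i ≡ j
    injective i j r = begin
        i                                         ≡⟨ sym (combine-remQuot {k} (k ^ m) i) ⟩
        combine (proj₁ (remQuot {k} (k ^ m) i)) (proj₂ (remQuot {k} (k ^ m) i))
          ≡⟨ cong₂ combine (injective₁ _ _ (r fzero)) (proj₁ (proj₂ E′) _ _ (λ x → r (fsuc x))) ⟩
        combine (proj₁ (remQuot {k} (k ^ m) j)) (proj₂ (remQuot {k} (k ^ m) j)) ≡⟨ combine-remQuot {k} (k ^ m) j ⟩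
        j                                         ∎
      where open ≡-Reasoning
    surjective : ∀ f → ∃[ i ] Pointwise R f (g i)
    surjective f = combine a b , subst (λ ab → Pointwise R f (cons (g₁ (proj₁ ab)) (g₂ (proj₂ ab))))
                                       (sym (remQuot-combine {k} {k ^ m} a b)) related
      where
        a = proj₁ (surjective₁ (f fzero))
        b = proj₁ (proj₂ (proj₂ E′) (λ x → f (fsuc x)))
        related : Pointwise R f (cons (g₁ a) (g₂ b))
        related fzero = proj₂ (surjective₁ (f fzero))
        related (fsuc x) = proj₂ (proj₂ (proj₂ E′) (λ x → f (fsuc x))) x

filter-indices : ∀ {k} (Q : Fin k → Set) → (∀ i → Dec (Q i)) →
  ∃[ k′ ] Σ[ e ∈ (Fin k′ → Fin k) ] ((∀ i → Q (e i)) × (∀ i j → e i ≡ e j → i ≡ j) × (∀ i → Q i → ∃[ i′ ] e i′ ≡ i))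
filter-indices {zero} Q Q? = 0 , (λ ()) , (λ ()) , (λ ()) , (λ ())
filter-indices {suc k} Q Q? with filter-indices (λ i → Q (fsuc i)) (λ i → Q? (fsuc i)) | Q? fzero
... | k′ , e , Qe , injective , surjective | yes Q0 = suc k′ , e′ , Qe′ , injective′ , surjective′
  where
    e′ : Fin (suc k′) → Fin (suc k)
    e′ fzero = fzero
    e′ (fsuc i) = fsuc (e i)
    Qe′ : ∀ i → Q (e′ i)
    Qe′ fzero = Q0
    Qe′ (fsuc i) = Qe i
    injective′ : ∀ i j → e′ i ≡ e′ j → i ≡ j
    injective′ fzero fzero _ = refl
    injective′ fzero (fsuc _) ()
    injective′ (fsuc _) fzero ()
    injective′ (fsuc i) (fsuc j) eq = cong fsuc (injective i j (fsuc-injective eq))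
    surjective′ : ∀ i → Q i → ∃[ i′ ] e′ i′ ≡ i
    surjective′ fzero _ = fzero , refl
    surjective′ (fsuc i) Qi = fsuc (proj₁ (surjective i Qi)) , cong fsuc (proj₂ (surjective i Qi))
... | k′ , e , Qe , injective , surjective | no ¬Q0 = k′ , (λ i → fsuc (e i)) , Qe , injective′ , surjective′
  where
    injective′ : ∀ i j → fsuc (e i) ≡ fsuc (e j) → i ≡ j
    injective′ i j eq = injective i j (fsuc-injective eq)
    surjective′ : ∀ i → Q i → ∃[ i′ ] fsuc (e i′) ≡ i
    surjective′ fzero Q0 = ⊥-elim (¬Q0 Q0)
    surjective′ (fsuc i) Qi = proj₁ (surjective i Qi) , cong (λ x → fsuc x) (proj₂ (surjective i Qi))

filter-count : ∀ {A R k} {P : A → Set} → Enumeration A R k → (∀ a → Dec (P a)) → (∀ {a b} → R a b → P a → P b) →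
  ∃[ k′ ] Count A P R k′
filter-count {R = R} {P = P} (g , injective , surjective) P? P-resp with filter-indices (λ i → P (g i)) (λ i → P? (g i))
... | k′ , e , Pe , e-injective , e-surjective = k′ , (λ i → g (e i)) , Pe ,
      (λ i j r → e-injective i j (injective (e i) (e j) r)) , surjective′
  where
    surjective′ : ∀ a → P a → ∃[ i ] R a (g (e i))
    surjective′ a Pa with surjective a
    ... | i , r with e-surjective i (P-resp r Pa)
    ...   | i′ , refl = i′ , r

module _ (m : ℕ) (D : DiagSet m) where
  private
    IsSide? : ∀ i j → Dec (IsSide m i j)
    IsSide? i j = (suc (toℕ i) ≟ toℕ j) ⊎-dec ((toℕ i ≟ 0) ×-dec (suc (toℕ j) ≟ m))
    _<?ᶠ_ : ∀ (i j : Fin m) → Dec (toℕ i < toℕ j)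
    i <?ᶠ j = toℕ i <? toℕ j
    Chosen? : ∀ i j → Dec (Chosen D i j)
    Chosen? i j = T? (D i j)
    Seg? : ∀ i j → Dec (Seg m D i j)
    Seg? i j = IsSide? i j ⊎-dec Chosen? i j

    WellFormed? : Dec (WellFormed m D)
    WellFormed? = all? λ i → all? λ j → Chosen? i j →-dec ((i <?ᶠ j) ×-dec ¬? (IsSide? i j))

    NonCrossing? : Dec (NonCrossing D)
    NonCrossing? = all? λ a → all? λ b → all? λ c → all? λ d →
      Chosen? a b →-dec (Chosen? c d →-dec ¬? ((a <?ᶠ c) ×-dec ((c <?ᶠ b) ×-dec (b <?ᶠ d))))

    HasTriangle? : Dec (HasTriangle m D)
    HasTriangle? = any? λ i → any? λ j → any? λ k →
      (i <?ᶠ j) ×-dec ((j <?ᶠ k) ×-dec (Seg? i j ×-dec (Seg? j k ×-dec Seg? i k)))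

    HasQuadrilateral? : Dec (HasQuadrilateral m D)
    HasQuadrilateral? = any? λ i → any? λ j → any? λ k → any? λ l →
      (i <?ᶠ j) ×-dec ((j <?ᶠ k) ×-dec ((k <?ᶠ l) ×-dec (Seg? i j ×-dec (Seg? j k ×-dec (Seg? k l ×-dec
        (Seg? i l ×-dec (¬? (Chosen? i k) ×-dec ¬? (Chosen? j l))))))))

  ValidPlacement? : Dec (ValidPlacement m D)
  ValidPlacement? = WellFormed? ×-dec (NonCrossing? ×-dec (¬? HasTriangle? ×-dec ¬? HasQuadrilateral?))

ValidPlacement-resp : ∀ {n} {D E : DiagSet (suc n)} → SameSet D E → ValidPlacement (suc n) D → ValidPlacement (suc n) E
ValidPlacement-resp {D = D} {E} same valid =
  Dissection⇒ValidPlacement (Dissection-resp (move same) (move (λ a b → sym (same a b))) (ValidPlacement⇒Dissection valid))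
  where
    move : ∀ {D D′ : DiagSet _} → SameSet D D′ → ∀ {x y} → Chosenℕ D x y → Chosenℕ D′ x y
    move same (x< , y< , c) = x< , y< , subst T (same _ _) c

placements : ∀ n → ∃[ k ] NumPlacements (suc n) k
placements n = filter-count (function-enumeration {R = Pointwise _≡_} (function-enumeration {R = _≡_} Bool-enumeration (suc n)) (suc n))
                 (ValidPlacement? (suc n)) ValidPlacement-resp

module _ {X Y : Set} {B : X → Set} {_~_ : X → X → Set} {V : Y → Set} {_≈_ : Y → Y → Set}
         (≈-sym : ∀ {y y′} → y ≈ y′ → y′ ≈ y) (≈-trans : ∀ {y y′ y″} → y ≈ y′ → y′ ≈ y″ → y ≈ y″)
         (δ : X → Y) (δ-valid : ∀ {x} → B x → V (δ x))
         (δ-reflects : ∀ {x x′} → δ x ≈ δ x′ → x ~ x′) (δ-preserves : ∀ {x x′} → x ~ x′ → δ x ≈ δ x′)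
         (δ-onto : ∀ {y} → V y → ∃[ x ] (B x × y ≈ δ x)) where

  Count-transfer : ∀ {k} → Count Y V _≈_ k → Count X B _~_ k
  Count-transfer (g , valid , injective , surjective) = g′ , (λ i → proj₁ (proj₂ (δ-onto (valid i)))) , injective′ , surjective′
    where
      g′ = λ i → proj₁ (δ-onto (valid i))
      g≈δg′ : ∀ i → g i ≈ δ (g′ i)
      g≈δg′ i = proj₂ (proj₂ (δ-onto (valid i)))
      injective′ : ∀ i j → g′ i ~ g′ j → i ≡ j
      injective′ i j r = injective i j (≈-trans (g≈δg′ i) (≈-trans (δ-preserves r) (≈-sym (g≈δg′ j))))
      surjective′ : ∀ x → B x → ∃[ i ] x ~ g′ i
      surjective′ x Bx with surjective (δ x) (δ-valid Bx)
      ... | i , r = i , δ-reflects (≈-trans r (g≈δg′ i))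

T-ext : ∀ {b b′} → (T b → T b′) → (T b′ → T b) → b ≡ b′
T-ext {false} {false} _ _ = refl
T-ext {false} {true} _ g = ⊥-elim (g _)
T-ext {true} {false} f _ = ⊥-elim (f _)
T-ext {true} {true} _ _ = refl

Diagonal-resp : ∀ {n} {P P′ : Perm n} → (∀ {c d} → Interval P c d → Interval P′ c d) →
  ∀ {x y} → Diagonals.Diagonal P x y → Diagonals.Diagonal P′ x y
Diagonal-resp same (x<y , y≤n , not-side , I) = x<y , y≤n , not-side , same I

SegmentOver-resp : ∀ {n C C′} → (∀ {x y} → C x y → C′ x y) → ∀ {c d} → SegmentOver n C c d → SegmentOver n C′ c d
SegmentOver-resp C⇒C′ (c≤d , d<n , seg) = c≤d , d<n , ⊎-map (λ side → side) C⇒C′ seg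

SamePoset⇒same-Interval : ∀ {n} {π σ : Permutation′ n} → SamePoset π σ → ∀ {c d} → Interval (toPerm π) c d → Interval (toPerm σ) c d
SamePoset⇒same-Interval {π = π} {σ} same I@(c≤d , d<n , _) with fin-of (≤-<-trans c≤d d<n) | fin-of d<n
... | C , refl | D , refl = Equivalence.to (IsInterval⇔Interval (toPerm-represents σ))
                              (Equivalence.to (same C D) (Equivalence.from (IsInterval⇔Interval (toPerm-represents π)) I))
  where open Representation

module _ {n : ℕ} where
  open Representation using (IsInterval⇔Interval)

  -- The dissection of the (n+1)-gon associated with π: {i, j} is chosen when
  -- [i, j-1] is an interval of π other than a singleton or everything.
  diagonals : Permutation′ n → DiagSet (suc n)
  diagonals π i j = isYes (Diagonals.Diagonal? (toPerm π) (toℕ i) (toℕ j))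

  chosen⇒Diagonal : ∀ π i j → Chosen (diagonals π) i j → Diagonals.Diagonal (toPerm π) (toℕ i) (toℕ j)
  chosen⇒Diagonal π i j = toWitness {a? = Diagonals.Diagonal? (toPerm π) (toℕ i) (toℕ j)}

  Diagonal⇒chosen : ∀ π i j → Diagonals.Diagonal (toPerm π) (toℕ i) (toℕ j) → Chosen (diagonals π) i j
  Diagonal⇒chosen π i j = fromWitness {a? = Diagonals.Diagonal? (toPerm π) (toℕ i) (toℕ j)}

  Chosenℕ-diagonals : ∀ π {x y} → Chosenℕ (diagonals π) x y ⇔ Diagonals.Diagonal (toPerm π) x y
  Chosenℕ-diagonals π = mk⇔
    (λ (x< , y< , chosen) → subst₂ (Diagonals.Diagonal (toPerm π)) (toℕ-fromℕ< x<) (toℕ-fromℕ< y<)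
                              (chosen⇒Diagonal π (fromℕ< x<) (fromℕ< y<) chosen))
    (λ d@(x<y , y≤n , _) → <-trans x<y (s≤s y≤n) , s≤s y≤n ,
       Diagonal⇒chosen π _ _ (subst₂ (Diagonals.Diagonal (toPerm π)) (sym (toℕ-fromℕ< _)) (sym (toℕ-fromℕ< _)) d))

  diagonals-valid : ∀ {π} → BlockWiseSimple π → ValidPlacement (suc n) (diagonals π)
  diagonals-valid {π} bws = Dissection⇒ValidPlacement
    (Dissection-resp (Equivalence.from (Chosenℕ-diagonals π)) (Equivalence.to (Chosenℕ-diagonals π))
      (Diagonals.dissection (toPerm π) (Representation.BlockWiseSimple⇒BWSimple (toPerm-represents π) bws)))

  SamePoset⇒SameSet : ∀ {π σ} → SamePoset π σ → SameSet (diagonals π) (diagonals σ)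
  SamePoset⇒SameSet {π} {σ} same i j = T-ext
    (λ c → Diagonal⇒chosen σ i j (Diagonal-resp {P = toPerm π} {toPerm σ} (SamePoset⇒same-Interval {π = π} {σ} same) (chosen⇒Diagonal π i j c)))
    (λ c → Diagonal⇒chosen π i j (Diagonal-resp {P = toPerm σ} {toPerm π} (SamePoset⇒same-Interval {π = σ} {π} (λ a b → ⇔-sym (same a b)))
                                                (chosen⇒Diagonal σ i j c)))
    where
      ⇔-sym : ∀ {A B : Set} → A ⇔ B → B ⇔ A
      ⇔-sym e = mk⇔ (Equivalence.from e) (Equivalence.to e)

  SameSet⇒same-IsInterval : ∀ {π σ} → SameSet (diagonals π) (diagonals σ) → ∀ {a b} → IsInterval π a b → IsInterval σ a b
  SameSet⇒same-IsInterval {π} {σ} same {a} {b} I =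
    Equivalence.from (IsInterval⇔Interval (toPerm-represents σ))
      (Equivalence.from (Diagonals.realizes (toPerm σ) (toℕ a) (toℕ b))
        (SegmentOver-resp {C = Diagonals.Diagonal (toPerm π)} {Diagonals.Diagonal (toPerm σ)} diagonal-π⇒σ
          (Equivalence.to (Diagonals.realizes (toPerm π) (toℕ a) (toℕ b))
            (Equivalence.to (IsInterval⇔Interval (toPerm-represents π)) I))))
    where
      diagonal-π⇒σ : ∀ {x y} → Diagonals.Diagonal (toPerm π) x y → Diagonals.Diagonal (toPerm σ) x y
      diagonal-π⇒σ {x} {y} d = Equivalence.to (Chosenℕ-diagonals σ {x} {y})
        (let (x< , y< , c) = Equivalence.from (Chosenℕ-diagonals π {x} {y}) d in x< , y< , subst T (same _ _) c)

  SameSet⇒SamePoset : ∀ {π σ} → SameSet (diagonals π) (diagonals σ) → SamePoset π σ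
  SameSet⇒SamePoset {π} {σ} same a b = mk⇔ (SameSet⇒same-IsInterval {π} {σ} same) (SameSet⇒same-IsInterval {σ} {π} (λ i j → sym (same i j)))

  valid-placement-realized : 1 ≤ n → ∀ {D} → ValidPlacement (suc n) D → ∃[ π ] (BlockWiseSimple π × SameSet D (diagonals π))
  valid-placement-realized 1≤n {D} valid = π , bws , same
    where
      Diss = ValidPlacement⇒Dissection valid
      P = proj₁ (realizable n 1≤n Diss)
      R = proj₂ (realizable n 1≤n Diss)
      π = fromPerm P
      bws : BlockWiseSimple π
      bws = Representation.BWSimple⇒BlockWiseSimple (represents-fromPerm P) (realizer-BWSimple Diss P R)
      same : SameSet D (diagonals π)
      same i j = T-ext
        (λ c → Diagonal⇒chosen π i j (Diagonal-resp {P = P} {toPerm π} (represents-same-Interval (represents-fromPerm P) (toPerm-represents π))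
                              (Equivalence.to (realized-diagonals Diss P R) (Chosen⇒Chosenℕ {D = D} i j c))))
        (λ c → Chosenℕ⇒Chosen {D = D} i j (Equivalence.from (realized-diagonals Diss P R)
                 (Diagonal-resp {P = toPerm π} {P} (represents-same-Interval (toPerm-represents π) (represents-fromPerm P)) (chosen⇒Diagonal π i j c))))

-- The implicit arguments are passed explicitly: left to unification, they make
-- Agda unfold diagonals, whose decision procedure is expensive to normalise.
NumPlacements⇒NumDistinctPosets : ∀ {n k} → n ≥ 1 → NumPlacements (suc n) k → NumDistinctPosets n k
NumPlacements⇒NumDistinctPosets {n} n≥1 =
  Count-transfer {Permutation′ n} {DiagSet (suc n)} {BlockWiseSimple} {SamePoset} {ValidPlacement (suc n)} {SameSet}
    (λ e a b → sym (e a b)) (λ e e′ a b → trans (e a b) (e′ a b)) diagonals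
    (λ {π} → diagonals-valid {π = π}) (λ {π} {σ} → SameSet⇒SamePoset {π = π} {σ})
    (λ {π} {σ} → SamePoset⇒SameSet {π = π} {σ}) (λ {D} → valid-placement-realized n≥1 {D})

theorem3 : ∀ (n : ℕ) → n ≥ 1 →
    ∃[ k ] (NumDistinctPosets n k × NumPlacements (suc n) k)
theorem3 n n≥1 = add-posets (placements n)
  where
    add-posets : ∃[ k ] NumPlacements (suc n) k → ∃[ k ] (NumDistinctPosets n k × NumPlacements (suc n) k)
    add-posets (k , counted) = k , NumPlacements⇒NumDistinctPosets n≥1 counted , counted
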